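{- Let $q$ be a power of an odd prime with $q\ge 17$ and $q\equiv 1\pmod 3$. Let $c_2,c_1,c_{ -1}\in\mathbb F_q$ and $J = X^3 + c_2X^2 + c_1X + c_{ -1}X^{q-2}\in\mathbb F_q[X]$, viewed as a function $\mathbb F_q\to\mathbb F_q$, and let $j$ be the restriction of $J$ to $\mathbb F_q^\times=\mathbb F_q\setminus\{0\}$. Then: 1. $J$ is not a permutation polynomial of $\mathbb F_q$; 2. $\#V_j \le \#V_J \le q-2$, and if in addition $0\notin V_j$, then $\#V_j\le q-3$.
   Context: A polynomial $f\in\mathbb F_q[X]$ is a permutation polynomial of $\mathbb F_q$ if the map $a\mapsto f(a)$ is a bijection of $\mathbb F_q$. For a function $f$, $V_f$ denotes its range (set of values) and $\#V_f = |V_f|$. -}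

module Defs where

open import Level using (Level; suc; _⊔_)
open import Data.Nat as ℕ using (ℕ; _∸_)
open import Data.Fin using (Fin)
open import Data.Fin.Properties using (any?)
open import Data.Product using (Σ; ∃; _×_; _,_)
open import Data.Product.Relation.Unary.All using ()
open import Data.Unit using (⊤)
open import Function.Bundles using (_↔_; Inverse)
open import Relation.Nullary using (¬_; Dec; yes; no)
open import Relation.Nullary.Decidable using (_×-dec_; ¬?)
open import Relation.Binary.PropositionalEquality using (_≡_; refl)
open import Algebra.Structures using (IsCommutativeRing)
import Algebra.Definitions.RawSemiring as RS
open import Algebra.Bundles using (RawSemiring)

record FiniteField (q : ℕ) : Set₁ where
  infixl 7 _*_
  infixl 6 _+_
  field
    Carrier : Set
    _+_ _*_ : Carrier → Carrier → Carrier
    -_      : Carrier → Carrier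
    0# 1#   : Carrier
    isCommutativeRing : IsCommutativeRing _≡_ _+_ _*_ -_ 0# 1#
    0≢1     : ¬ (0# ≡ 1#)
    inverse : ∀ x → ¬ (x ≡ 0#) → ∃ λ y → x * y ≡ 1#
    _≟_     : (x y : Carrier) → Dec (x ≡ y)
    enum    : Fin q ↔ Carrier

  rawSemiring : RawSemiring _ _
  rawSemiring = record { Carrier = Carrier ; _≈_ = _≡_ ; _+_ = _+_ ; _*_ = _*_ ; 0# = 0# ; 1# = 1# }

  open RS rawSemiring public using (_^_)

  elt : Fin q → Carrier
  elt = Inverse.to enum

count : ∀ {n} {P : Fin n → Set} → ((i : Fin n) → Dec (P i)) → ℕ
count {ℕ.zero} P? = 0
count {ℕ.suc n} P? with P? Fin.zero
... | yes _ = ℕ.suc (count (λ i → P? (Fin.suc i)))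
... | no _  = count (λ i → P? (Fin.suc i))

module _ {q : ℕ} (F : FiniteField q) where
  open FiniteField F

  InRange : (Carrier → Carrier) → Carrier → Set
  InRange f y = ∃ λ x → f x ≡ y

  InRangeˣ : (Carrier → Carrier) → Carrier → Set
  InRangeˣ f y = ∃ λ x → ¬ (x ≡ 0#) × f x ≡ y

  #V : (Carrier → Carrier) → ℕ
  #V f = count (λ i → dec i)
    where
    dec : (i : Fin q) → Dec (InRange f (elt i))
    dec i with any? (λ k → f (elt k) ≟ elt i)
    ... | yes (k , e) = yes (elt k , e)
    ... | no ¬p = no λ { (x , e) → ¬p (Inverse.from enum x , subst′ x e) }
      where
      subst′ : ∀ x → f x ≡ elt i → f (elt (Inverse.from enum x)) ≡ elt i
      subst′ x e rewrite Inverse.inverseˡ enum {x} refl = e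

  #Vˣ : (Carrier → Carrier) → ℕ
  #Vˣ f = count (λ i → dec i)
    where
    dec : (i : Fin q) → Dec (InRangeˣ f (elt i))
    dec i with any? (λ k → ¬? (elt k ≟ 0#) ×-dec (f (elt k) ≟ elt i))
    ... | yes (k , e) = yes (elt k , e)
    ... | no ¬p = no λ { (x , e) → ¬p (Inverse.from enum x , subst′ x e) }
      where
      subst′ : ∀ x → ¬ (x ≡ 0#) × f x ≡ elt i
             → ¬ (elt (Inverse.from enum x) ≡ 0#) × f (elt (Inverse.from enum x)) ≡ elt i
      subst′ x e rewrite Inverse.inverseˡ enum {x} refl = e

  J : (c₂ c₁ c₋₁ : Carrier) → Carrier → Carrier
  J c₂ c₁ c₋₁ x = x ^ 3 + c₂ * x ^ 2 + c₁ * x + c₋₁ * x ^ (q ∸ 2)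

{-# OPTIONS --safe #-}
module Submission where

-- If J permuted F_q, then ∑ₓ J(x)ᵗ = 0 for 0 < t < q - 1. Writing J(x) = x³ + c₂x² + c₁x + c₋₁x⁻¹ with
-- x⁻¹ = x^(q-2), the sum over F_q of a monomial xᵃx⁻ᵇ vanishes unless a = b ≥ 1, when it is -1; the cases
-- t = 2, 3, 4 then force c₋₁ = 0. The remaining cubic takes equal values at two explicit points built from a
-- primitive cube root of unity, which exists because 3 ∣ q - 1.
--
-- For the value sets, ∑ J = 0 = ∑ x, so if changing J at one point p makes it injective, the new value is J(p).
-- Used at p = 0 this shows that J already collides on F_q^×; if moreover 0 ∉ V_j, using it at a point of that
-- collision produces a second one. Each collision (or J(x₀) = 0 = J(0) with x₀ ≠ 0) costs a value.

open import Defs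
open import Level using (0ℓ)
open import Data.Nat as ℕ using (ℕ; zero; suc; _≤_; _<_; _∸_; _%_; _≤ᵇ_; z≤n; s≤s)
import Data.Nat.Properties as ℕP
import Data.Nat.DivMod as ℕD
open import Data.Integer as ℤ using (ℤ)
import Data.Integer.Properties as ℤP
open import Data.Sign as Sign using (Sign)
open import Data.Bool using (T; true; false; if_then_else_)
open import Data.Unit using (⊤; tt)
open import Data.Maybe using (Maybe; just; nothing)
open import Data.Fin as Fin using (Fin)
import Data.Fin.Properties as FinP
import Data.Fin.Permutation as Perm
open import Data.List using (List; []; _∷_; length; replicate)
import Data.List.Properties as ListP
open import Data.Vec.Functional using (removeAt)
open import Data.Product using (∃; ∃₂; _×_; _,_; proj₁; proj₂)
open import Data.Sum using (_⊎_; inj₁; inj₂; [_,_]′)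
open import Function using (_∘_; id; case_of_)
open import Function.Bundles using (_↔_; Inverse)
open import Function.Definitions using (Injective)
open import Relation.Nullary using (¬_; Dec; yes; no; contradiction)
open import Relation.Nullary.Decidable using (¬?; _×-dec_; _⊎-dec_; map′; decidable-stable)
open import Relation.Unary using (Pred; Decidable; _⊆_)
open import Relation.Binary.PropositionalEquality hiding (J)
open import Relation.Binary.Definitions using (DecidableEquality; tri<; tri≈; tri>)
open import Algebra.Core using (Op₁; Op₂)
open import Algebra.Bundles using (CommutativeMonoid; CommutativeRing)
open import Algebra.Structures using (IsCommutativeMonoid; IsCommutativeRing)
open import Algebra.Solver.Ring.AlmostCommutativeRing using (fromCommutativeRing; _-Raw-AlmostCommutative⟶_)

module IntegerCoefficientSolver
  {A : Set} {add mul : Op₂ A} {neg : Op₁ A} {0ᴬ 1ᴬ : A}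
  (isCommutativeRing : IsCommutativeRing _≡_ add mul neg 0ᴬ 1ᴬ) where

  open import Data.Integer using (+_; -[1+_])

  ring : CommutativeRing _ _
  ring = record { isCommutativeRing = isCommutativeRing }

  open CommutativeRing ring using (_+_; _*_; -_; 0#; 1#; _-_; +-comm; *-identityˡ; *-identityʳ; zeroʳ; +-identityʳ)
  open import Algebra.Properties.Ring (CommutativeRing.ring ring)
    using (-‿involutive; -1*x≈-x; -‿anti-homo-+; -0#≈0#)
  open import Algebra.Properties.Monoid.Mult (CommutativeRing.+-monoid ring)
    using (×-homo-+) renaming (_×_ to _×ₘ_)
  open import Algebra.Properties.Semiring.Mult (CommutativeRing.semiring ring)
    using (×1-homo-*)
  open import Algebra.Properties.AbelianGroup (CommutativeRing.+-abelianGroup ring)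
    using (xyx⁻¹≈y; ⁻¹-anti-homo‿-)
  open import Algebra.Properties.CommutativeSemigroup (CommutativeRing.*-commutativeSemigroup ring)
    using (interchange)
  open ≡-Reasoning

  -- The solver's constant con (ℤ.+ n) denotes fromℕ n; in particular it writes 1 as fromℕ 1 = 1# + 0#.
  fromℕ : ℕ → A
  fromℕ n = n ×ₘ 1#

  fromℕ-+ : ∀ m n → fromℕ (m ℕ.+ n) ≡ fromℕ m + fromℕ n
  fromℕ-+ = ×-homo-+ 1#

  fromℕ-* : ∀ m n → fromℕ (m ℕ.* n) ≡ fromℕ m * fromℕ n
  fromℕ-* = ×1-homo-*

  fromℤ : ℤ → A
  fromℤ (+ n)    = fromℕ n
  fromℤ -[1+ n ] = - fromℕ (suc n)

  fromSign : Sign → A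
  fromSign Sign.+ = 1#
  fromSign Sign.- = - 1#

  fromSign-* : ∀ s t → fromSign (s Sign.* t) ≡ fromSign s * fromSign t
  fromSign-* Sign.+ t      = sym (*-identityˡ _)
  fromSign-* Sign.- Sign.+ = sym (*-identityʳ _)
  fromSign-* Sign.- Sign.- = sym (trans (-1*x≈-x (- 1#)) (-‿involutive 1#))

  fromℤ-◃ : ∀ s n → fromℤ (s ℤ.◃ n) ≡ fromSign s * fromℕ n
  fromℤ-◃ s       zero    = sym (zeroʳ _)
  fromℤ-◃ Sign.+ (suc n) = sym (*-identityˡ _)
  fromℤ-◃ Sign.- (suc n) = sym (-1*x≈-x _)

  fromℤ-signAbs : ∀ i → fromℤ i ≡ fromSign (ℤ.sign i) * fromℕ ℤ.∣ i ∣
  fromℤ-signAbs i = trans (cong fromℤ (sym (ℤP.◃-inverse i))) (fromℤ-◃ (ℤ.sign i) ℤ.∣ i ∣)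

  fromℤ-* : ∀ i j → fromℤ (i ℤ.* j) ≡ fromℤ i * fromℤ j
  fromℤ-* i j = begin
    fromℤ (i ℤ.* j)                                  ≡⟨ fromℤ-◃ (ℤ.sign i Sign.* ℤ.sign j) (ℤ.∣ i ∣ ℕ.* ℤ.∣ j ∣) ⟩
    fromSign (ℤ.sign i Sign.* ℤ.sign j) * fromℕ (ℤ.∣ i ∣ ℕ.* ℤ.∣ j ∣)
      ≡⟨ cong₂ _*_ (fromSign-* (ℤ.sign i) (ℤ.sign j)) (fromℕ-* ℤ.∣ i ∣ ℤ.∣ j ∣) ⟩
    (s * t) * (m * n)                                ≡⟨ interchange s t m n ⟩
    (s * m) * (t * n)                                ≡⟨ sym (cong₂ _*_ (fromℤ-signAbs i) (fromℤ-signAbs j)) ⟩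
    fromℤ i * fromℤ j                                ∎
    where
    s t m n : A
    s = fromSign (ℤ.sign i)
    t = fromSign (ℤ.sign j)
    m = fromℕ ℤ.∣ i ∣
    n = fromℕ ℤ.∣ j ∣

  fromℤ-neg : ∀ i → fromℤ (ℤ.- i) ≡ - fromℤ i
  fromℤ-neg -[1+ n ]    = sym (-‿involutive _)
  fromℤ-neg (+ zero)    = sym -0#≈0#
  fromℤ-neg (+ suc n)   = refl

  fromℤ-⊖-≥ : ∀ {m n} → n ℕ.≤ m → fromℤ (m ℤ.⊖ n) ≡ fromℕ m - fromℕ n
  fromℤ-⊖-≥ {m} {n} n≤m = begin
    fromℤ (m ℤ.⊖ n)                       ≡⟨ cong fromℤ (ℤP.⊖-≥ n≤m) ⟩
    fromℕ (m ℕ.∸ n)                       ≡⟨ sym (xyx⁻¹≈y (fromℕ n) _) ⟩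
    fromℕ n + fromℕ (m ℕ.∸ n) - fromℕ n   ≡⟨ cong (_- fromℕ n) (sym (fromℕ-+ n (m ℕ.∸ n))) ⟩
    fromℕ (n ℕ.+ (m ℕ.∸ n)) - fromℕ n     ≡⟨ cong (λ k → fromℕ k - fromℕ n) (ℕP.m+[n∸m]≡n n≤m) ⟩
    fromℕ m - fromℕ n                     ∎

  fromℤ-⊖ : ∀ m n → fromℤ (m ℤ.⊖ n) ≡ fromℕ m - fromℕ n
  fromℤ-⊖ m n with ℕP.≤-total n m
  ... | inj₁ n≤m = fromℤ-⊖-≥ n≤m
  ... | inj₂ m≤n = begin
    fromℤ (m ℤ.⊖ n)          ≡⟨ cong fromℤ (ℤP.⊖-swap m n) ⟩
    fromℤ (ℤ.- (n ℤ.⊖ m))    ≡⟨ fromℤ-neg (n ℤ.⊖ m) ⟩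
    - fromℤ (n ℤ.⊖ m)        ≡⟨ cong -_ (fromℤ-⊖-≥ m≤n) ⟩
    - (fromℕ n - fromℕ m)    ≡⟨ ⁻¹-anti-homo‿- (fromℕ n) (fromℕ m) ⟩
    fromℕ m - fromℕ n        ∎

  fromℤ-+ : ∀ i j → fromℤ (i ℤ.+ j) ≡ fromℤ i + fromℤ j
  fromℤ-+ -[1+ m ] -[1+ n ] = begin
    - fromℕ (suc (suc (m ℕ.+ n)))           ≡⟨ cong (λ k → - fromℕ (suc k)) (sym (ℕP.+-suc m n)) ⟩
    - fromℕ (suc m ℕ.+ suc n)               ≡⟨ cong -_ (fromℕ-+ (suc m) (suc n)) ⟩
    - (fromℕ (suc m) + fromℕ (suc n))       ≡⟨ -‿anti-homo-+ _ _ ⟩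
    - fromℕ (suc n) + - fromℕ (suc m)       ≡⟨ +-comm _ _ ⟩
    - fromℕ (suc m) + - fromℕ (suc n)       ∎
  fromℤ-+ -[1+ m ] (+ n)    = trans (fromℤ-⊖ n (suc m)) (+-comm _ _)
  fromℤ-+ (+ m)    -[1+ n ] = fromℤ-⊖ m (suc n)
  fromℤ-+ (+ m)    (+ n)    = fromℕ-+ m n

  fromℤ-morphism : ℤ.+-*-rawRing -Raw-AlmostCommutative⟶ fromCommutativeRing ring
  fromℤ-morphism = record
    { ⟦_⟧ = fromℤ ; +-homo = fromℤ-+ ; *-homo = fromℤ-* ; -‿homo = fromℤ-neg
    ; 0-homo = refl ; 1-homo = +-identityʳ 1# }

  fromℤ-≟ : ∀ i j → Maybe (fromℤ i ≡ fromℤ j)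
  fromℤ-≟ i j with i ℤ.≟ j
  ... | yes i≡j = just (cong fromℤ i≡j)
  ... | no _    = nothing

  open import Algebra.Solver.Ring ℤ.+-*-rawRing (fromCommutativeRing ring) fromℤ-morphism fromℤ-≟ public

count-mono : ∀ {n} {P Q : Pred (Fin n) 0ℓ} (P? : Decidable P) (Q? : Decidable Q) → P ⊆ Q → count P? ≤ count Q?
count-mono {n = zero}  P? Q? P⊆Q = z≤n
count-mono {n = suc n} P? Q? P⊆Q with P? Fin.zero | Q? Fin.zero
... | yes p | no ¬q = contradiction (P⊆Q p) ¬q
... | yes _ | yes _ = s≤s (count-mono (P? ∘ Fin.suc) (Q? ∘ Fin.suc) P⊆Q)
... | no _  | yes _ = ℕP.m≤n⇒m≤1+n (count-mono (P? ∘ Fin.suc) (Q? ∘ Fin.suc) P⊆Q)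
... | no _  | no _  = count-mono (P? ∘ Fin.suc) (Q? ∘ Fin.suc) P⊆Q

count-∅ : ∀ {n} {P : Pred (Fin n) 0ℓ} (P? : Decidable P) → (∀ i → ¬ P i) → count P? ≡ 0
count-∅ {n = zero}  P? ∅ = refl
count-∅ {n = suc n} P? ∅ with P? Fin.zero
... | yes p = contradiction p (∅ Fin.zero)
... | no _  = count-∅ (P? ∘ Fin.suc) (∅ ∘ Fin.suc)

count-full : ∀ {n} {P : Pred (Fin n) 0ℓ} (P? : Decidable P) → (∀ i → P i) → count P? ≡ n
count-full {n = zero}  P? full = refl
count-full {n = suc n} P? full with P? Fin.zero
... | yes _ = cong suc (count-full (P? ∘ Fin.suc) (full ∘ Fin.suc))
... | no ¬p = contradiction (full Fin.zero) ¬p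

count-⊎ : ∀ {n} {P Q : Pred (Fin n) 0ℓ} (P? : Decidable P) (Q? : Decidable Q) →
          count (λ i → P? i ⊎-dec Q? i) ≤ count P? ℕ.+ count Q?
count-⊎ {n = zero}  P? Q? = z≤n
count-⊎ {n = suc n} P? Q? with P? Fin.zero | Q? Fin.zero
... | yes _ | yes _ = s≤s (ℕP.≤-trans (count-⊎ (P? ∘ Fin.suc) (Q? ∘ Fin.suc)) (ℕP.+-monoʳ-≤ _ (ℕP.n≤1+n _)))
... | yes _ | no _  = s≤s (count-⊎ (P? ∘ Fin.suc) (Q? ∘ Fin.suc))
... | no _  | yes _ = ℕP.≤-trans (s≤s (count-⊎ (P? ∘ Fin.suc) (Q? ∘ Fin.suc)))
                                 (ℕP.≤-reflexive (sym (ℕP.+-suc _ _)))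
... | no _  | no _  = count-⊎ (P? ∘ Fin.suc) (Q? ∘ Fin.suc)

count-subsingleton : ∀ {n} {P : Pred (Fin n) 0ℓ} (P? : Decidable P) → (∀ {i j} → P i → P j → i ≡ j) → count P? ≤ 1
count-subsingleton {n = zero}  P? unique = z≤n
count-subsingleton {n = suc n} P? unique with P? Fin.zero
... | yes p = s≤s (ℕP.≤-reflexive (count-∅ (P? ∘ Fin.suc) (λ i pᵢ → FinP.0≢1+n (unique p pᵢ))))
... | no _  = count-subsingleton (P? ∘ Fin.suc) (λ pᵢ pⱼ → FinP.suc-injective (unique pᵢ pⱼ))

count+count¬ : ∀ {n} {P : Pred (Fin n) 0ℓ} (P? : Decidable P) → count P? ℕ.+ count (¬? ∘ P?) ≡ n
count+count¬ {n = zero}  P? = refl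
count+count¬ {n = suc n} P? with P? Fin.zero
... | yes _ = cong suc (count+count¬ (P? ∘ Fin.suc))
... | no _  = trans (ℕP.+-suc _ _) (cong suc (count+count¬ (P? ∘ Fin.suc)))

count-< : ∀ {n} {P Q : Pred (Fin n) 0ℓ} (P? : Decidable P) (Q? : Decidable Q) → P ⊆ Q → ∀ k → ¬ P k → Q k → count P? < count Q?
count-< {suc n} P? Q? P⊆Q k ¬pₖ qₖ with P? Fin.zero | Q? Fin.zero | k
... | yes p | no ¬q | _       = contradiction (P⊆Q p) ¬q
... | yes p | _     | Fin.zero = contradiction p ¬pₖ
... | no _  | no ¬q | Fin.zero = contradiction qₖ ¬q
... | no _  | yes _ | Fin.zero = s≤s (count-mono (P? ∘ Fin.suc) (Q? ∘ Fin.suc) P⊆Q)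
... | yes _ | yes _ | Fin.suc k = s≤s (count-< (P? ∘ Fin.suc) (Q? ∘ Fin.suc) P⊆Q k ¬pₖ qₖ)
... | no _  | yes _ | Fin.suc k = ℕP.m≤n⇒m≤1+n (count-< (P? ∘ Fin.suc) (Q? ∘ Fin.suc) P⊆Q k ¬pₖ qₖ)
... | no _  | no _  | Fin.suc k = count-< (P? ∘ Fin.suc) (Q? ∘ Fin.suc) P⊆Q k ¬pₖ qₖ

count-<⇒∃ : ∀ {n} {P Q : Pred (Fin n) 0ℓ} (P? : Decidable P) (Q? : Decidable Q) → count P? < count Q? → ∃ λ i → Q i × ¬ P i
count-<⇒∃ {P = P} {Q} P? Q? P<Q with FinP.any? (λ i → Q? i ×-dec ¬? (P? i))
... | yes witness = witness
... | no none     = contradiction (count-mono Q? P? Q⊆P) (ℕP.<⇒≱ P<Q)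
  where
  Q⊆P : Q ⊆ P
  Q⊆P {i} qᵢ with P? i
  ... | yes pᵢ = pᵢ
  ... | no ¬pᵢ = contradiction (i , qᵢ , ¬pᵢ) none

module _ {A : Set} (_≟_ : DecidableEquality A) {n : ℕ} (e : Fin n → A) (e-injective : Injective _≡_ _≡_ e) where

  count-image : ∀ {m} {D : Pred (Fin m) 0ℓ} (D? : Decidable D) (g : Fin m → A)
                {Im : Pred (Fin n) 0ℓ} (Im? : Decidable Im) →
                (∀ {i} → Im i → ∃ λ k → D k × g k ≡ e i) → count Im? ≤ count D?
  count-image {zero} D? g Im? Im⊆g[D] = ℕP.≤-reflexive (count-∅ Im? (λ i imᵢ → case Im⊆g[D] imᵢ of λ ()))
  count-image {suc m} {D} D? g {Im} Im? Im⊆g[D] with D? Fin.zero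
  ... | yes _ = begin
    count Im?                                 ≤⟨ count-mono Im? (λ i → Hit? i ⊎-dec Tail? i) Im⊆Hit∪Tail ⟩
    count (λ i → Hit? i ⊎-dec Tail? i)        ≤⟨ count-⊎ Hit? Tail? ⟩
    count Hit? ℕ.+ count Tail?                ≤⟨ ℕP.+-mono-≤ (count-subsingleton Hit? (λ p q → e-injective (trans (sym p) q)))
                                                             (count-image (D? ∘ Fin.suc) (g ∘ Fin.suc) Tail? id) ⟩
    1 ℕ.+ count (D? ∘ Fin.suc)                ∎
    where
    open ℕP.≤-Reasoning
    Hit? : Decidable (λ i → g Fin.zero ≡ e i)
    Hit? i = g Fin.zero ≟ e i
    Tail? : Decidable (λ i → ∃ λ k → D (Fin.suc k) × g (Fin.suc k) ≡ e i)
    Tail? i = FinP.any? (λ k → D? (Fin.suc k) ×-dec (g (Fin.suc k) ≟ e i))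
    Im⊆Hit∪Tail : Im ⊆ λ i → g Fin.zero ≡ e i ⊎ ∃ λ k → D (Fin.suc k) × g (Fin.suc k) ≡ e i
    Im⊆Hit∪Tail imᵢ with Im⊆g[D] imᵢ
    ... | Fin.zero  , _ , hit = inj₁ hit
    ... | Fin.suc k , d , hit = inj₂ (k , d , hit)
  ... | no ¬d₀ = count-image (D? ∘ Fin.suc) (g ∘ Fin.suc) Im? Im⊆g[D∘suc]
    where
    Im⊆g[D∘suc] : ∀ {i} → Im i → ∃ λ k → D (Fin.suc k) × g (Fin.suc k) ≡ e i
    Im⊆g[D∘suc] imᵢ with Im⊆g[D] imᵢ
    ... | Fin.zero  , d , _   = contradiction d ¬d₀
    ... | Fin.suc k , d , hit = k , d , hit

injective⇒surjective : ∀ {n} {f : Fin n → Fin n} → Injective _≡_ _≡_ f → ∀ j → ∃ λ i → f i ≡ j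
injective⇒surjective {suc n} {f} f-injective j with FinP.any? (λ i → f i FinP.≟ j)
... | yes hit = hit
... | no miss = contradiction (FinP.injective⇒≤ f′-injective) ℕP.1+n≰n
  where
  j≢f : ∀ i → j ≢ f i
  j≢f i j≡fi = miss (i , sym j≡fi)
  f′ : Fin (suc n) → Fin n
  f′ i = Fin.punchOut (j≢f i)
  f′-injective : Injective _≡_ _≡_ f′
  f′-injective = f-injective ∘ FinP.punchOut-injective (j≢f _) (j≢f _)

module EnumeratedSum {D : Set} {n : ℕ} (enum : Fin n ↔ D)
  {A : Set} {op : Op₂ A} {e : A} (isCommutativeMonoid : IsCommutativeMonoid _≡_ op e) where

  monoid : CommutativeMonoid _ _
  monoid = record { isCommutativeMonoid = isCommutativeMonoid }

  open CommutativeMonoid monoid using (_∙_; ε)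
  open import Algebra.Properties.CommutativeSemigroup (CommutativeMonoid.commutativeSemigroup monoid)
    using (xy∙z≈zy∙x)
  open import Algebra.Properties.CommutativeMonoid.Sum monoid
    using (sum; sum-cong-≗; ∑-distrib-+; ∑-permute; sum-replicate; sum-remove)
  open import Algebra.Definitions.RawMonoid (CommutativeMonoid.rawMonoid monoid) using () renaming (_×_ to _×ₘ_)
  open Inverse enum using () renaming (to to elt; from to index)
  open ≡-Reasoning

  ∑ : (D → A) → A
  ∑ f = sum (f ∘ elt)

  elt-index : ∀ x → elt (index x) ≡ x
  elt-index x = Inverse.strictlyInverseˡ enum x

  index-elt : ∀ i → index (elt i) ≡ i
  index-elt i = Inverse.strictlyInverseʳ enum i

  elt-injective : Injective _≡_ _≡_ elt
  elt-injective {i} {j} eᵢ≡eⱼ = trans (sym (index-elt i)) (trans (cong index eᵢ≡eⱼ) (index-elt j))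

  ∑-closed : ∀ {P : A → Set} → P ε → (∀ {a b} → P a → P b → P (a ∙ b)) →
             ∀ f → (∀ x → P (f x)) → P (∑ f)
  ∑-closed {P} Pε P∙ f Pf = sum-closed (f ∘ elt) (Pf ∘ elt)
    where
    sum-closed : ∀ {m} (t : Fin m → A) → (∀ i → P (t i)) → P (sum t)
    sum-closed {zero}  t Pt = Pε
    sum-closed {suc m} t Pt = P∙ (Pt Fin.zero) (sum-closed (t ∘ Fin.suc) (Pt ∘ Fin.suc))

  ∑-cong : ∀ {f g} → (∀ x → f x ≡ g x) → ∑ f ≡ ∑ g
  ∑-cong f≗g = sum-cong-≗ (f≗g ∘ elt)

  ∑-distrib : ∀ f g → ∑ (λ x → f x ∙ g x) ≡ ∑ f ∙ ∑ g
  ∑-distrib f g = ∑-distrib-+ (f ∘ elt) (g ∘ elt)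

  ∑-const : ∀ k → ∑ (λ _ → k) ≡ n ×ₘ k
  ∑-const k = sum-replicate n

  ∑-reindex : ∀ {σ} → Injective _≡_ _≡_ σ → ∀ f → ∑ (f ∘ σ) ≡ ∑ f
  ∑-reindex {σ} σ-injective f = sym (begin
    ∑ f                              ≡⟨ ∑-permute (f ∘ elt) π ⟩
    sum (λ i → f (elt (index (σ (elt i))))) ≡⟨ sum-cong-≗ (λ i → cong f (elt-index (σ (elt i)))) ⟩
    ∑ (f ∘ σ)                        ∎)
    where
    h : Fin n → Fin n
    h = index ∘ σ ∘ elt
    h-injective : Injective _≡_ _≡_ h
    h-injective hᵢ≡hⱼ = elt-injective (σ-injective (trans (sym (elt-index _)) (trans (cong elt hᵢ≡hⱼ) (elt-index _))))
    h⁻¹ : Fin n → Fin n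
    h⁻¹ = proj₁ ∘ injective⇒surjective h-injective
    π : Perm.Permutation n n
    π = Perm.permutation h h⁻¹ (proj₂ ∘ injective⇒surjective h-injective)
          (λ i → h-injective (proj₂ (injective⇒surjective h-injective (h i))))

  sum-update : ∀ {m} (t u : Fin m → A) i → (∀ j → j ≢ i → t j ≡ u j) → sum t ∙ u i ≡ sum u ∙ t i
  sum-update {suc m} t u i t≡u = begin
    sum t ∙ u i                                 ≡⟨ cong (_∙ u i) (sum-remove {i = i} t) ⟩
    (t i ∙ sum (removeAt t i)) ∙ u i            ≡⟨ cong (λ s → (t i ∙ s) ∙ u i) rest ⟩
    (t i ∙ sum (removeAt u i)) ∙ u i            ≡⟨ xy∙z≈zy∙x (t i) _ (u i) ⟩
    (u i ∙ sum (removeAt u i)) ∙ t i            ≡⟨ cong (_∙ t i) (sum-remove {i = i} u) ⟨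
    sum u ∙ t i                                 ∎
    where
    rest : sum (removeAt t i) ≡ sum (removeAt u i)
    rest = sum-cong-≗ (λ j → t≡u (Fin.punchIn i j) (FinP.punchInᵢ≢i i j))

  ∑-update : ∀ f g p → (∀ x → x ≢ p → f x ≡ g x) → ∑ f ∙ g p ≡ ∑ g ∙ f p
  ∑-update f g p f≡g = begin
    ∑ f ∙ g p                  ≡⟨ cong (λ x → ∑ f ∙ g x) (elt-index p) ⟨
    ∑ f ∙ g (elt (index p))    ≡⟨ sum-update (f ∘ elt) (g ∘ elt) (index p) f∘elt≡g∘elt ⟩
    ∑ g ∙ f (elt (index p))    ≡⟨ cong (λ x → ∑ g ∙ f x) (elt-index p) ⟩
    ∑ g ∙ f p                  ∎
    where
    f∘elt≡g∘elt : ∀ j → j ≢ index p → f (elt j) ≡ g (elt j)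
    f∘elt≡g∘elt j j≢p = f≡g (elt j) (λ eⱼ≡p → j≢p (trans (sym (index-elt j)) (cong index eⱼ≡p)))

module FiniteFieldProperties {q : ℕ} (F : FiniteField q) where

  open FiniteField F
  open IntegerCoefficientSolver isCommutativeRing public
    using (ring; fromℕ; fromℕ-+; fromℕ-*; solve; _:=_; _:+_; _:*_; _:-_; :-_; _:^_; con)
  open CommutativeRing ring public using (_-_; +-comm; *-comm; *-assoc; *-identityˡ; *-identityʳ;
    +-identityˡ; +-identityʳ; -‿inverseˡ; -‿inverseʳ; zeroˡ; zeroʳ; +-isCommutativeMonoid; *-isCommutativeMonoid; +-group)
  open import Algebra.Properties.Group +-group using (∙-cancelˡ; x∙y⁻¹≈ε⇒x≈y; x≈y⇒x∙y⁻¹≈ε; inverseˡ-unique)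
  open import Algebra.Properties.Semiring.Sum (CommutativeRing.semiring ring) using (*-distribˡ-sum)
  open import Algebra.Properties.CommutativeSemiring.Exp (CommutativeRing.commutativeSemiring ring) public
    using (^-distrib-*)
  open import Algebra.Properties.Semiring.Exp (CommutativeRing.semiring ring) public
    using (^-homo-*; ^-assocʳ)
  module Σ = EnumeratedSum enum +-isCommutativeMonoid
  module Π = EnumeratedSum enum *-isCommutativeMonoid
  open Σ public using (elt-index; elt-injective; ∑; ∑-cong; ∑-distrib; ∑-reindex; ∑-update)
  open ≡-Reasoning

  ∑-*ˡ : ∀ k f → ∑ (λ x → k * f x) ≡ k * ∑ f
  ∑-*ˡ k f = sym (*-distribˡ-sum k (f ∘ elt))

  x+y≡0⇒x≡-y : ∀ {x y} → x + y ≡ 0# → x ≡ - y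
  x+y≡0⇒x≡-y = inverseˡ-unique _ _

  1≢0 : 1# ≢ 0#
  1≢0 = 0≢1 ∘ sym

  x-y≡0⇒x≡y : ∀ {x y} → x - y ≡ 0# → x ≡ y
  x-y≡0⇒x≡y = x∙y⁻¹≈ε⇒x≈y _ _

  x≡y⇒x-y≡0 : ∀ {x y} → x ≡ y → x - y ≡ 0#
  x≡y⇒x-y≡0 = x≈y⇒x∙y⁻¹≈ε

  +-cancelˡ : ∀ a {x y} → a + x ≡ a + y → x ≡ y
  +-cancelˡ a = ∙-cancelˡ a _ _

  x*y≡0⇒x≡0⊎y≡0 : ∀ x y → x * y ≡ 0# → x ≡ 0# ⊎ y ≡ 0#
  x*y≡0⇒x≡0⊎y≡0 x y xy≡0 with x ≟ 0#
  ... | yes x≡0 = inj₁ x≡0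
  ... | no x≢0  = inj₂ (begin
    y               ≡⟨ *-identityʳ y ⟨
    y * 1#          ≡⟨ cong (y *_) (proj₂ (inverse x x≢0)) ⟨
    y * (x * x⁻¹)   ≡⟨ solve 3 (λ x y z → y :* (x :* z) := (x :* y) :* z) refl x y x⁻¹ ⟩
    (x * y) * x⁻¹   ≡⟨ cong (_* x⁻¹) xy≡0 ⟩
    0# * x⁻¹        ≡⟨ zeroˡ x⁻¹ ⟩
    0#              ∎)
    where
    x⁻¹ : Carrier
    x⁻¹ = proj₁ (inverse x x≢0)

  x*y≢0 : ∀ {x y} → x ≢ 0# → y ≢ 0# → x * y ≢ 0#
  x*y≢0 {x} {y} x≢0 y≢0 xy≡0 with x*y≡0⇒x≡0⊎y≡0 x y xy≡0
  ... | inj₁ x≡0 = x≢0 x≡0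
  ... | inj₂ y≡0 = y≢0 y≡0

  x*y≡0⇒y≡0 : ∀ {x y} → x ≢ 0# → x * y ≡ 0# → y ≡ 0#
  x*y≡0⇒y≡0 {x} {y} x≢0 xy≡0 with x*y≡0⇒x≡0⊎y≡0 x y xy≡0
  ... | inj₁ x≡0 = contradiction x≡0 x≢0
  ... | inj₂ y≡0 = y≡0

  x*y≡0⇒x≡0 : ∀ {x y} → y ≢ 0# → x * y ≡ 0# → x ≡ 0#
  x*y≡0⇒x≡0 {x} {y} y≢0 xy≡0 = x*y≡0⇒y≡0 y≢0 (trans (*-comm y x) xy≡0)

  *-cancelˡ : ∀ {a x y} → a ≢ 0# → a * x ≡ a * y → x ≡ y
  *-cancelˡ {a} {x} {y} a≢0 ax≡ay = x-y≡0⇒x≡y (x*y≡0⇒y≡0 a≢0 (begin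
    a * (x - y)     ≡⟨ solve 3 (λ a x y → a :* (x :- y) := a :* x :- a :* y) refl a x y ⟩
    a * x - a * y   ≡⟨ x≡y⇒x-y≡0 ax≡ay ⟩
    0#              ∎))

  *-injective : ∀ {a} → a ≢ 0# → Injective _≡_ _≡_ (a *_)
  *-injective a≢0 = *-cancelˡ a≢0

  fromℕ[q]≡0 : fromℕ q ≡ 0#
  fromℕ[q]≡0 = +-cancelˡ (∑ id) (begin
    ∑ id + fromℕ q               ≡⟨ cong (∑ id +_) (Σ.∑-const 1#) ⟨
    ∑ id + ∑ (λ _ → 1#)          ≡⟨ ∑-distrib id (λ _ → 1#) ⟨
    ∑ (λ x → x + 1#)             ≡⟨ ∑-reindex (λ {x} {y} → shift-injective) id ⟩
    ∑ id                         ≡⟨ +-identityʳ (∑ id) ⟨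
    ∑ id + 0#                    ∎)
    where
    shift-injective : ∀ {x y} → x + 1# ≡ y + 1# → x ≡ y
    shift-injective {x} {y} e = +-cancelˡ 1# (trans (+-comm 1# x) (trans e (+-comm y 1#)))

  fromℕ-% : ∀ k n .{{_ : ℕ.NonZero k}} → fromℕ k ≡ 0# → fromℕ n ≡ fromℕ (n % k)
  fromℕ-% k n fromℕ[k]≡0 = begin
    fromℕ n                                          ≡⟨ cong fromℕ (ℕD.m≡m%n+[m/n]*n n k) ⟩
    fromℕ (n % k ℕ.+ (n ℕ./ k) ℕ.* k)                ≡⟨ fromℕ-+ (n % k) _ ⟩
    fromℕ (n % k) + fromℕ ((n ℕ./ k) ℕ.* k)          ≡⟨ cong (fromℕ (n % k) +_) (fromℕ-* (n ℕ./ k) k) ⟩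
    fromℕ (n % k) + fromℕ (n ℕ./ k) * fromℕ k        ≡⟨ cong (λ z → fromℕ (n % k) + fromℕ (n ℕ./ k) * z) fromℕ[k]≡0 ⟩
    fromℕ (n % k) + fromℕ (n ℕ./ k) * 0#             ≡⟨ cong (fromℕ (n % k) +_) (zeroʳ _) ⟩
    fromℕ (n % k) + 0#                               ≡⟨ +-identityʳ _ ⟩
    fromℕ (n % k)                                    ∎

  fromℕ≢0 : ∀ k .{{_ : ℕ.NonZero k}} → q % k ≡ 1 → fromℕ k ≢ 0#
  fromℕ≢0 k q%k≡1 fromℕ[k]≡0 = 1≢0 (begin
    1#                ≡⟨ +-identityʳ 1# ⟨
    fromℕ 1           ≡⟨ cong fromℕ q%k≡1 ⟨
    fromℕ (q % k)     ≡⟨ fromℕ-% k q fromℕ[k]≡0 ⟨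
    fromℕ q           ≡⟨ fromℕ[q]≡0 ⟩
    0#                ∎)

  1≤q : 1 ≤ q
  1≤q = ℕP.≤-trans (s≤s z≤n) (FinP.toℕ<n (Inverse.from enum 0#))

  _^[_≢0] : Carrier → Carrier → Carrier
  a ^[ x ≢0] with x ≟ 0#
  ... | yes _ = 1#
  ... | no _  = a

  ^[0≢0] : ∀ a → a ^[ 0# ≢0] ≡ 1#
  ^[0≢0] a with 0# ≟ 0#
  ... | yes _   = refl
  ... | no 0≢0 = contradiction refl 0≢0

  ^[≢0] : ∀ a {x} → x ≢ 0# → a ^[ x ≢0] ≡ a
  ^[≢0] a {x} x≢0 with x ≟ 0#
  ... | yes x≡0 = contradiction x≡0 x≢0
  ... | no _    = refl

  x^[x≢0]≢0 : ∀ x → x ^[ x ≢0] ≢ 0#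
  x^[x≢0]≢0 x with x ≟ 0#
  ... | yes _   = 1≢0
  ... | no x≢0 = x≢0

  ^[≢0]-* : ∀ {a} → a ≢ 0# → ∀ x → (a * x) ^[ a * x ≢0] ≡ a ^[ x ≢0] * x ^[ x ≢0]
  ^[≢0]-* {a} a≢0 x with (a * x) ≟ 0# | x ≟ 0#
  ... | yes _     | yes _    = sym (*-identityˡ 1#)
  ... | yes ax≡0  | no x≢0  = contradiction ax≡0 (x*y≢0 a≢0 x≢0)
  ... | no ax≢0   | yes x≡0 = contradiction (trans (cong (a *_) x≡0) (zeroʳ a)) ax≢0
  ... | no _      | no _     = refl

  -- Multiplication by a ≠ 0 permutes F; comparing the products of x ^[ x ≢0] before and after gives a^(q-1) = 1.
  x^q≡x : ∀ a → a ^ q ≡ a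
  x^q≡x a with a ≟ 0#
  ... | yes refl = trans (cong (0# ^_) (sym (ℕP.m+[n∸m]≡n 1≤q))) (zeroˡ _)
  ... | no a≢0   = *-cancelˡ P≢0 (begin
    P * a ^ q                       ≡⟨ cong (P *_) (*-identityʳ (a ^ q)) ⟨
    P * (a ^ q * 1#)                ≡⟨ cong₂ (λ y z → P * (y * z)) (Π.∑-const a) (^[0≢0] a) ⟨
    P * (Π.∑ (λ _ → a) * a ^[ 0# ≢0]) ≡⟨ cong (P *_) (Π.∑-update (λ _ → a) (a ^[_≢0]) 0# (λ x x≢0 → sym (^[≢0] a x≢0))) ⟩
    P * (Π.∑ (a ^[_≢0]) * a)        ≡⟨ cong (λ z → P * (z * a)) Πa^[≢0]≡1 ⟩
    P * (1# * a)                    ≡⟨ cong (P *_) (*-identityˡ a) ⟩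
    P * a                           ∎)
    where
    P : Carrier
    P = Π.∑ (λ x → x ^[ x ≢0])
    P≢0 : P ≢ 0#
    P≢0 = Π.∑-closed {P = _≢ 0#} 1≢0 x*y≢0 (λ x → x ^[ x ≢0]) x^[x≢0]≢0
    Πa^[≢0]≡1 : Π.∑ (a ^[_≢0]) ≡ 1#
    Πa^[≢0]≡1 = *-cancelˡ P≢0 (begin
      P * Π.∑ (a ^[_≢0])                         ≡⟨ *-comm P _ ⟩
      Π.∑ (a ^[_≢0]) * P                         ≡⟨ Π.∑-distrib (a ^[_≢0]) (λ x → x ^[ x ≢0]) ⟨
      Π.∑ (λ x → a ^[ x ≢0] * x ^[ x ≢0])        ≡⟨ Π.∑-cong (^[≢0]-* a≢0) ⟨
      Π.∑ (λ x → (a * x) ^[ a * x ≢0])           ≡⟨ Π.∑-reindex (*-injective a≢0) (λ y → y ^[ y ≢0]) ⟩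
      P                                          ≡⟨ *-identityʳ P ⟨
      P * 1#                                     ∎)

  x≢0⇒x^[q∸1]≡1 : ∀ {x} → x ≢ 0# → x ^ (q ∸ 1) ≡ 1#
  x≢0⇒x^[q∸1]≡1 {x} x≢0 = *-cancelˡ x≢0 (begin
    x * x ^ (q ∸ 1)          ≡⟨⟩
    x ^ suc (q ∸ 1)          ≡⟨ cong (x ^_) (ℕP.m+[n∸m]≡n 1≤q) ⟩
    x ^ q                    ≡⟨ x^q≡x x ⟩
    x                        ≡⟨ *-identityʳ x ⟨
    x * 1#                   ∎)

module RootCounting {q : ℕ} (F : FiniteField q) where

  open FiniteField F
  open FiniteFieldProperties F

  -- c₀ ∷ … ∷ cₙ₋₁ denotes the monic polynomial c₀ + c₁X + … + cₙ₋₁Xⁿ⁻¹ + Xⁿ.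
  evalMonic : List Carrier → Carrier → Carrier
  evalMonic []       x = 1#
  evalMonic (c ∷ cs) x = c + x * evalMonic cs x

  divide : List Carrier → Carrier → List Carrier
  divide []            r = []
  divide (c ∷ [])      r = []
  divide (c ∷ c′ ∷ cs) r = evalMonic (c′ ∷ cs) r ∷ divide (c′ ∷ cs) r

  length-divide : ∀ c cs r → length (divide (c ∷ cs) r) ≡ length cs
  length-divide c []        r = refl
  length-divide c (c′ ∷ cs) r = cong suc (length-divide c′ cs r)

  evalMonic-divide : ∀ c cs r x →
    evalMonic (c ∷ cs) x ≡ evalMonic (c ∷ cs) r + (x - r) * evalMonic (divide (c ∷ cs) r) x
  evalMonic-divide c [] r x = solve 4 (λ c x r o → c :+ x :* o := (c :+ r :* o) :+ (x :- r) :* o) refl c x r 1#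
  evalMonic-divide c (c′ ∷ cs) r x = begin
    c + x * evalMonic (c′ ∷ cs) x            ≡⟨ cong (λ p → c + x * p) (evalMonic-divide c′ cs r x) ⟩
    c + x * (p′ + (x - r) * h)               ≡⟨ solve 5 (λ c x r p h → c :+ x :* (p :+ (x :- r) :* h)
                                                         := (c :+ r :* p) :+ (x :- r) :* (p :+ x :* h)) refl c x r p′ h ⟩
    (c + r * p′) + (x - r) * (p′ + x * h)    ∎
    where
    open ≡-Reasoning
    p′ h : Carrier
    p′ = evalMonic (c′ ∷ cs) r
    h  = evalMonic (divide (c′ ∷ cs) r) x

  factor-theorem : ∀ c cs {r} → evalMonic (c ∷ cs) r ≡ 0# →
                   ∀ x → evalMonic (c ∷ cs) x ≡ (x - r) * evalMonic (divide (c ∷ cs) r) x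
  factor-theorem c cs {r} r-root x = begin
    evalMonic (c ∷ cs) x                                      ≡⟨ evalMonic-divide c cs r x ⟩
    evalMonic (c ∷ cs) r + (x - r) * evalMonic (divide (c ∷ cs) r) x ≡⟨ cong (λ v → v + (x - r) * evalMonic (divide (c ∷ cs) r) x) r-root ⟩
    0# + (x - r) * evalMonic (divide (c ∷ cs) r) x            ≡⟨ +-identityˡ _ ⟩
    (x - r) * evalMonic (divide (c ∷ cs) r) x                 ∎
    where open ≡-Reasoning

  root? : ∀ cs → Decidable (λ i → evalMonic cs (elt i) ≡ 0#)
  root? cs i = evalMonic cs (elt i) ≟ 0#

  count-root≤degree : ∀ cs → count (root? cs) ≤ length cs
  count-root≤degree cs = bound (length cs) cs refl
    where
    bound : ∀ n cs → length cs ≡ n → count (root? cs) ≤ n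
    bound zero    []       _ = ℕP.≤-reflexive (count-∅ (root? []) (λ _ → 1≢0))
    bound (suc n) (c ∷ cs) |cs|≡n with FinP.any? (root? (c ∷ cs))
    ... | no none = ℕP.≤-trans (ℕP.≤-reflexive (count-∅ (root? (c ∷ cs)) (λ i root → none (i , root)))) z≤n
    ... | yes (i , r-root) = begin
      count (root? (c ∷ cs))                     ≤⟨ count-mono (root? (c ∷ cs)) (λ j → is-r? j ⊎-dec root? h j) root⇒r∨h-root ⟩
      count (λ j → is-r? j ⊎-dec root? h j)      ≤⟨ count-⊎ is-r? (root? h) ⟩
      count is-r? ℕ.+ count (root? h)            ≤⟨ ℕP.+-mono-≤ (count-subsingleton is-r? (λ p q → elt-injective (trans p (sym q))))
                                                                 (bound n h (trans (length-divide c cs r) (ℕP.suc-injective |cs|≡n))) ⟩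
      suc n                                      ∎
      where
      open ℕP.≤-Reasoning
      r : Carrier
      r = elt i
      h : List Carrier
      h = divide (c ∷ cs) r
      is-r? : Decidable (λ j → elt j ≡ r)
      is-r? j = elt j ≟ r
      root⇒r∨h-root : ∀ {j} → evalMonic (c ∷ cs) (elt j) ≡ 0# → elt j ≡ r ⊎ evalMonic h (elt j) ≡ 0#
      root⇒r∨h-root {j} root
        with x*y≡0⇒x≡0⊎y≡0 (elt j - r) (evalMonic h (elt j)) (trans (sym (factor-theorem c cs r-root (elt j))) root)
      ... | inj₁ eⱼ-r≡0 = inj₁ (x-y≡0⇒x≡y eⱼ-r≡0)
      ... | inj₂ h-root = inj₂ h-root

  nonzero? : Decidable (λ i → elt i ≢ 0#)
  nonzero? i = ¬? (elt i ≟ 0#)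

  q∸1≤count-nonzero : q ∸ 1 ≤ count nonzero?
  q∸1≤count-nonzero = begin
    q ∸ 1                                     ≡⟨ cong (_∸ 1) (count+count¬ zero?) ⟨
    count zero? ℕ.+ count nonzero? ∸ 1        ≤⟨ ℕP.∸-monoˡ-≤ 1 (ℕP.+-monoˡ-≤ _ (count-subsingleton zero? unique)) ⟩
    count nonzero?                            ∎
    where
    open ℕP.≤-Reasoning
    zero? : Decidable (λ i → elt i ≡ 0#)
    zero? i = elt i ≟ 0#
    unique : ∀ {i j} → elt i ≡ 0# → elt j ≡ 0# → i ≡ j
    unique eᵢ≡0 eⱼ≡0 = elt-injective (trans eᵢ≡0 (sym eⱼ≡0))

  evalMonic-replicate : ∀ k x → evalMonic (replicate k 0#) x ≡ x ^ k
  evalMonic-replicate zero    x = refl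
  evalMonic-replicate (suc k) x = trans (+-identityˡ _) (cong (x *_) (evalMonic-replicate k x))

  ∃x^k≢1 : ∀ {k} → 0 < k → k < q ∸ 1 → ∃ λ a → a ≢ 0# × a ^ k ≢ 1#
  ∃x^k≢1 {suc k} _ k<q∸1
    with count-<⇒∃ (root? x^k-1) nonzero? (ℕP.<-≤-trans (ℕP.≤-<-trans (count-root≤degree x^k-1) |x^k-1|<q∸1) q∸1≤count-nonzero)
    where
    x^k-1 : List Carrier
    x^k-1 = - 1# ∷ replicate k 0#
    |x^k-1|<q∸1 : length x^k-1 < q ∸ 1
    |x^k-1|<q∸1 = subst (_< q ∸ 1) (cong suc (sym (ListP.length-replicate k))) k<q∸1
  ... | i , eᵢ≢0 , ¬root = elt i , eᵢ≢0 , λ eᵢ^k≡1 → ¬root (begin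
    - 1# + elt i * evalMonic (replicate k 0#) (elt i)   ≡⟨ cong (λ p → - 1# + elt i * p) (evalMonic-replicate k (elt i)) ⟩
    - 1# + elt i ^ suc k                               ≡⟨ cong (- 1# +_) eᵢ^k≡1 ⟩
    - 1# + 1#                                          ≡⟨ -‿inverseˡ 1# ⟩
    0#                                                 ∎)
    where open ≡-Reasoning

  ∑x^k≡0 : ∀ {k} → 0 < k → k < q ∸ 1 → ∑ (_^ k) ≡ 0#
  ∑x^k≡0 {k} 0<k k<q∸1 with ∃x^k≢1 0<k k<q∸1
  ... | a , a≢0 , a^k≢1 = x*y≡0⇒y≡0 (a^k≢1 ∘ x-y≡0⇒x≡y) (begin
    (a ^ k - 1#) * S                ≡⟨ solve 3 (λ A S o → (A :- o) :* S := A :* S :- o :* S) refl (a ^ k) S 1# ⟩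
    a ^ k * S - 1# * S              ≡⟨ cong₂ _-_ a^k*S≡S (*-identityˡ S) ⟩
    S - S                           ≡⟨ -‿inverseʳ S ⟩
    0#                              ∎)
    where
    open ≡-Reasoning
    S : Carrier
    S = ∑ (_^ k)
    a^k*S≡S : a ^ k * S ≡ S
    a^k*S≡S = begin
      a ^ k * S                     ≡⟨ ∑-*ˡ (a ^ k) (_^ k) ⟨
      ∑ (λ x → a ^ k * x ^ k)       ≡⟨ ∑-cong (λ x → ^-distrib-* a x k) ⟨
      ∑ (λ x → (a * x) ^ k)         ≡⟨ ∑-reindex (*-injective a≢0) (_^ k) ⟩
      S                             ∎

  ∑-injective-^≡0 : ∀ {f : Carrier → Carrier} → Injective _≡_ _≡_ f → ∀ {k} → 0 < k → k < q ∸ 1 → ∑ (λ x → f x ^ k) ≡ 0#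
  ∑-injective-^≡0 {f} f-injective {k} 0<k k<q∸1 = trans (∑-reindex f-injective (_^ k)) (∑x^k≡0 0<k k<q∸1)

module LaurentSums {q : ℕ} (F : FiniteField q) (3≤q : 3 ≤ q) where

  open FiniteField F
  open FiniteFieldProperties F
  open RootCounting F
  open ≡-Reasoning

  infix 10 _⁻¹

  -- Inversion as a polynomial function; note that 0 ⁻¹ = 0.
  _⁻¹ : Carrier → Carrier
  x ⁻¹ = x ^ (q ∸ 2)

  0⁻¹≡0 : 0# ⁻¹ ≡ 0#
  0⁻¹≡0 = trans (cong (λ n → 0# ^ (n ∸ 2)) (sym (ℕP.m+[n∸m]≡n 3≤q))) (zeroˡ _)

  x*x⁻¹≡1 : ∀ {x} → x ≢ 0# → x * x ⁻¹ ≡ 1#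
  x*x⁻¹≡1 {x} x≢0 = trans (cong (λ n → x ^ (n ∸ 1)) (ℕP.m+[n∸m]≡n (ℕP.≤-trans (ℕP.n≤1+n 2) 3≤q)))
                          (x≢0⇒x^[q∸1]≡1 x≢0)

  x⁻¹≢0 : ∀ {x} → x ≢ 0# → x ⁻¹ ≢ 0#
  x⁻¹≢0 {x} x≢0 x⁻¹≡0 = 1≢0 (trans (sym (x*x⁻¹≡1 x≢0)) (trans (cong (x *_) x⁻¹≡0) (zeroʳ x)))

  ⁻¹-involutive : ∀ x → x ⁻¹ ⁻¹ ≡ x
  ⁻¹-involutive x with x ≟ 0#
  ... | yes refl = trans (cong _⁻¹ 0⁻¹≡0) 0⁻¹≡0
  ... | no x≢0   = *-cancelˡ (x⁻¹≢0 x≢0) (trans (x*x⁻¹≡1 (x⁻¹≢0 x≢0)) (sym (trans (*-comm _ x) (x*x⁻¹≡1 x≢0))))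

  ⁻¹-injective : ∀ {x y} → x ⁻¹ ≡ y ⁻¹ → x ≡ y
  ⁻¹-injective {x} {y} x⁻¹≡y⁻¹ = trans (sym (⁻¹-involutive x)) (trans (cong _⁻¹ x⁻¹≡y⁻¹) (⁻¹-involutive y))

  monomial : ℕ → ℕ → Carrier → Carrier
  monomial a b x = x ^ a * x ⁻¹ ^ b

  1^n≡1 : ∀ n → 1# ^ n ≡ 1#
  1^n≡1 zero    = refl
  1^n≡1 (suc n) = trans (*-identityˡ _) (1^n≡1 n)

  monomial-diagonal : ∀ a {x} → x ≢ 0# → monomial a a x ≡ 1#
  monomial-diagonal a {x} x≢0 = trans (sym (^-distrib-* x (x ⁻¹) a)) (trans (cong (_^ a) (x*x⁻¹≡1 x≢0)) (1^n≡1 a))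

  monomial-shift : ∀ b d x → monomial (b ℕ.+ suc d) b x ≡ x ^ suc d
  monomial-shift b d x with x ≟ 0#
  ... | yes refl = begin
    0# ^ (b ℕ.+ suc d) * 0# ⁻¹ ^ b     ≡⟨ cong (λ n → 0# ^ n * 0# ⁻¹ ^ b) (ℕP.+-suc b d) ⟩
    0# * 0# ^ (b ℕ.+ d) * 0# ⁻¹ ^ b    ≡⟨ solve 2 (λ u v → con (ℤ.+ 0) :* u :* v := con (ℤ.+ 0)) refl _ _ ⟩
    0#                                 ≡⟨ zeroˡ _ ⟨
    0# ^ suc d                         ∎
  ... | no x≢0 = begin
    x ^ (b ℕ.+ suc d) * x ⁻¹ ^ b       ≡⟨ cong (_* x ⁻¹ ^ b) (^-homo-* x b (suc d)) ⟩
    x ^ b * x ^ suc d * x ⁻¹ ^ b       ≡⟨ solve 3 (λ u v w → u :* v :* w := v :* (u :* w)) refl (x ^ b) (x ^ suc d) (x ⁻¹ ^ b) ⟩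
    x ^ suc d * monomial b b x         ≡⟨ cong (x ^ suc d *_) (monomial-diagonal b x≢0) ⟩
    x ^ suc d * 1#                     ≡⟨ *-identityʳ _ ⟩
    x ^ suc d                          ∎

  ∑-monomial-comm : ∀ a b → ∑ (monomial a b) ≡ ∑ (monomial b a)
  ∑-monomial-comm a b = begin
    ∑ (monomial a b)                ≡⟨ ∑-cong swap ⟩
    ∑ (monomial b a ∘ _⁻¹)          ≡⟨ ∑-reindex ⁻¹-injective (monomial b a) ⟩
    ∑ (monomial b a)                ∎
    where
    swap : ∀ x → monomial a b x ≡ monomial b a (x ⁻¹)
    swap x = trans (*-comm _ _) (cong (λ y → x ⁻¹ ^ b * y ^ a) (sym (⁻¹-involutive x)))

  ∑-monomial-> : ∀ {a b} → a ≤ q ∸ 2 → b < a → ∑ (monomial a b) ≡ 0#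
  ∑-monomial-> {a} {b} a≤q∸2 b<a = begin
    ∑ (monomial a b)                ≡⟨ cong (λ n → ∑ (monomial n b)) (sym a≡b+d) ⟩
    ∑ (monomial (b ℕ.+ suc d) b)    ≡⟨ ∑-cong (monomial-shift b d) ⟩
    ∑ (_^ suc d)                    ≡⟨ ∑x^k≡0 (s≤s z≤n) 1+d<q∸1 ⟩
    0#                              ∎
    where
    d : ℕ
    d = a ∸ suc b
    a≡b+d : b ℕ.+ suc d ≡ a
    a≡b+d = trans (ℕP.+-suc b d) (ℕP.m+[n∸m]≡n b<a)
    1+d<q∸1 : suc d < q ∸ 1
    1+d<q∸1 = ℕP.≤-<-trans (ℕP.≤-trans (ℕP.m≤n+m (suc d) b) (subst (_≤ q ∸ 2) (sym a≡b+d) a≤q∸2))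
                           (ℕP.∸-monoʳ-< (ℕP.n<1+n 1) (ℕP.≤-trans (ℕP.n≤1+n 2) 3≤q))

  ∑1≡0 : ∑ (λ _ → 1#) ≡ 0#
  ∑1≡0 = trans (Σ.∑-const 1#) fromℕ[q]≡0

  ∑-monomial-off-diagonal : ∀ {a b} → a ≤ q ∸ 2 → b ≤ q ∸ 2 → (a ≡ b → a ≡ 0) → ∑ (monomial a b) ≡ 0#
  ∑-monomial-off-diagonal {a} {b} a≤ b≤ a≡b⇒a≡0 with ℕP.<-cmp a b
  ... | tri< a<b _ _ = trans (∑-monomial-comm a b) (∑-monomial-> b≤ a<b)
  ... | tri> _ _ b<a = ∑-monomial-> a≤ b<a
  ... | tri≈ _ refl _ with a≡b⇒a≡0 refl
  ...   | refl = trans (∑-cong (λ _ → *-identityˡ 1#)) ∑1≡0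

  ∑-monomial-diagonal : ∀ a → ∑ (monomial (suc a) (suc a)) ≡ - 1#
  ∑-monomial-diagonal a = x+y≡0⇒x≡-y (begin
    ∑ (monomial (suc a) (suc a)) + 1#
      ≡⟨ ∑-update (monomial (suc a) (suc a)) (λ _ → 1#) 0# (λ _ → monomial-diagonal (suc a)) ⟩
    ∑ (λ _ → 1#) + monomial (suc a) (suc a) 0#              ≡⟨ cong₂ _+_ ∑1≡0 (trans (cong (_* 0# ⁻¹ ^ suc a) (zeroˡ _)) (zeroˡ _)) ⟩
    0# + 0#                                                 ≡⟨ +-identityʳ 0# ⟩
    0#                                                      ∎)

  -- (k , a , b) stands for the term k X^a X^-b.
  Laurent : Set
  Laurent = List (Carrier × ℕ × ℕ)

  evalLaurent : Laurent → Carrier → Carrier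
  evalLaurent []                  x = 0#
  evalLaurent ((k , a , b) ∷ ts) x = k * monomial a b x + evalLaurent ts x

  -- The coefficients of the terms XᵃX⁻ᵃ with a ≥ 1, the only monomials whose sum over F is nonzero.
  diagonal : Laurent → Carrier
  diagonal []                        = 0#
  diagonal ((k , suc a , suc b) ∷ ts) = if a ℕ.≡ᵇ b then k + diagonal ts else diagonal ts
  diagonal (_ ∷ ts)                  = diagonal ts

  ExponentsAtMost : ℕ → Laurent → Set
  ExponentsAtMost n []                  = ⊤
  ExponentsAtMost n ((_ , a , b) ∷ ts) = T (a ≤ᵇ n) × T (b ≤ᵇ n) × ExponentsAtMost n ts

  ∑-evalLaurent-∷ : ∀ k a b ts → ∑ (evalLaurent ((k , a , b) ∷ ts)) ≡ k * ∑ (monomial a b) + ∑ (evalLaurent ts)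
  ∑-evalLaurent-∷ k a b ts = trans (∑-distrib (λ x → k * monomial a b x) (evalLaurent ts)) (cong (_+ _) (∑-*ˡ k (monomial a b)))

  ∑-evalLaurent-∷-off : ∀ k a b ts {d} → ∑ (monomial a b) ≡ 0# → ∑ (evalLaurent ts) + d ≡ 0# →
                        ∑ (evalLaurent ((k , a , b) ∷ ts)) + d ≡ 0#
  ∑-evalLaurent-∷-off k a b ts {d} ∑m≡0 IH = begin
    ∑ (evalLaurent ((k , a , b) ∷ ts)) + d             ≡⟨ cong (_+ d) (∑-evalLaurent-∷ k a b ts) ⟩
    k * ∑ (monomial a b) + ∑ (evalLaurent ts) + d      ≡⟨ cong (λ s → k * s + ∑ (evalLaurent ts) + d) ∑m≡0 ⟩
    k * 0# + ∑ (evalLaurent ts) + d                    ≡⟨ solve 3 (λ k r d → k :* con (ℤ.+ 0) :+ r :+ d := r :+ d) refl k _ d ⟩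
    ∑ (evalLaurent ts) + d                             ≡⟨ IH ⟩
    0#                                                 ∎

  ∑-evalLaurent-∷-diagonal : ∀ k a b ts {d} → ∑ (monomial a b) ≡ - 1# → ∑ (evalLaurent ts) + d ≡ 0# →
                             ∑ (evalLaurent ((k , a , b) ∷ ts)) + (k + d) ≡ 0#
  ∑-evalLaurent-∷-diagonal k a b ts {d} ∑m≡-1 IH = begin
    ∑ (evalLaurent ((k , a , b) ∷ ts)) + (k + d)       ≡⟨ cong (_+ (k + d)) (∑-evalLaurent-∷ k a b ts) ⟩
    k * ∑ (monomial a b) + ∑ (evalLaurent ts) + (k + d) ≡⟨ cong (λ s → k * s + ∑ (evalLaurent ts) + (k + d)) ∑m≡-1 ⟩
    k * - 1# + ∑ (evalLaurent ts) + (k + d)            ≡⟨ cong (λ z → k * - 1# + ∑ (evalLaurent ts) + (z + d)) (*-identityʳ k) ⟨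
    k * - 1# + ∑ (evalLaurent ts) + (k * 1# + d)       ≡⟨ solve 4 (λ k r d o → k :* (:- o) :+ r :+ (k :* o :+ d) := r :+ d) refl k _ d 1# ⟩
    ∑ (evalLaurent ts) + d                             ≡⟨ IH ⟩
    0#                                                 ∎

  ∑-evalLaurent-step : ∀ k a b ts → a ≤ q ∸ 2 → b ≤ q ∸ 2 → ∑ (evalLaurent ts) + diagonal ts ≡ 0# →
                       ∑ (evalLaurent ((k , a , b) ∷ ts)) + diagonal ((k , a , b) ∷ ts) ≡ 0#
  ∑-evalLaurent-step k zero    b ts a≤ b≤ IH = ∑-evalLaurent-∷-off k 0 b ts (∑-monomial-off-diagonal a≤ b≤ (λ _ → refl)) IH
  ∑-evalLaurent-step k (suc a) zero ts a≤ b≤ IH = ∑-evalLaurent-∷-off k (suc a) 0 ts (∑-monomial-off-diagonal a≤ b≤ (λ ())) IH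
  ∑-evalLaurent-step k (suc a) (suc b) ts a≤ b≤ IH with a ℕ.≡ᵇ b in a≡ᵇb
  ... | true  = subst (λ c → ∑ (evalLaurent ((k , suc a , c) ∷ ts)) + (k + diagonal ts) ≡ 0#) (cong suc a≡b)
                  (∑-evalLaurent-∷-diagonal k (suc a) (suc a) ts (∑-monomial-diagonal a) IH)
    where
    a≡b : a ≡ b
    a≡b = ℕP.≡ᵇ⇒≡ a b (subst T (sym a≡ᵇb) tt)
  ... | false = ∑-evalLaurent-∷-off k (suc a) (suc b) ts (∑-monomial-off-diagonal a≤ b≤ 1+a≢1+b) IH
    where
    1+a≢1+b : suc a ≡ suc b → suc a ≡ 0
    1+a≢1+b e = contradiction (subst T a≡ᵇb (ℕP.≡⇒≡ᵇ a b (ℕP.suc-injective e))) λ ()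

  ∑-evalLaurent : ∀ {n} → n ≤ q ∸ 2 → ∀ ts → ExponentsAtMost n ts → ∑ (evalLaurent ts) + diagonal ts ≡ 0#
  ∑-evalLaurent n≤q∸2 [] _ = trans (+-identityʳ _) (trans (∑-cong (λ x → sym (zeroˡ x))) (trans (∑-*ˡ 0# (λ x → x)) (zeroˡ _)))
  ∑-evalLaurent {n} n≤q∸2 ((k , a , b) ∷ ts) (a≤n , b≤n , ts≤n) =
    ∑-evalLaurent-step k a b ts (bounded a a≤n) (bounded b b≤n) (∑-evalLaurent n≤q∸2 ts ts≤n)
    where
    bounded : ∀ m → T (m ≤ᵇ n) → m ≤ q ∸ 2
    bounded m m≤ᵇn = ℕP.≤-trans (ℕP.≤ᵇ⇒≤ m n m≤ᵇn) n≤q∸2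

module CubeRoots {q : ℕ} (F : FiniteField q) where

  open FiniteField F
  open FiniteFieldProperties F
  open RootCounting F

  ∃ω : 2 ≤ q → q % 3 ≡ 1 → ∃ λ ω → ω ^ 3 ≡ 1# × ω ≢ 1#
  ∃ω 2≤q q%3≡1 with q ℕ./ 3 | q≡1+[q/3]*3
    where
    q≡1+[q/3]*3 : q ≡ 1 ℕ.+ (q ℕ./ 3) ℕ.* 3
    q≡1+[q/3]*3 = trans (ℕD.m≡m%n+[m/n]*n q 3) (cong (ℕ._+ (q ℕ./ 3) ℕ.* 3) q%3≡1)
  ... | zero  | q≡1 = contradiction (subst (2 ≤_) q≡1 2≤q) λ { (s≤s ()) }
  ... | suc e | q≡1+[1+e]*3 with ∃x^k≢1 (s≤s z≤n) 1+e<q∸1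
    where
    1+e<q∸1 : suc e < q ∸ 1
    1+e<q∸1 = subst (suc e <_) (cong (_∸ 1) (sym q≡1+[1+e]*3)) (s≤s (s≤s (ℕP.m≤n⇒m≤1+n (ℕP.m≤m*n e 3))))
  ...   | a , a≢0 , a^[1+e]≢1 = a ^ suc e , ω³≡1 , a^[1+e]≢1
    where
    ω³≡1 : (a ^ suc e) ^ 3 ≡ 1#
    ω³≡1 = trans (^-assocʳ a (suc e) 3) (trans (cong (λ n → a ^ (n ∸ 1)) (sym q≡1+[1+e]*3)) (x≢0⇒x^[q∸1]≡1 a≢0))

  module CubicCollision (3≢0 : fromℕ 3 ≢ 0#) {ω} (ω³≡1 : ω ^ 3 ≡ 1#) (ω≢1 : ω ≢ 1#) (c₂ c₁ : Carrier) where

    open ≡-Reasoning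

    cubic : Carrier → Carrier
    cubic = J F c₂ c₁ 0#

    ω³≡fromℕ1 : ω ^ 3 ≡ fromℕ 1
    ω³≡fromℕ1 = trans ω³≡1 (sym (+-identityʳ 1#))

    ω-1≢0 : ω - fromℕ 1 ≢ 0#
    ω-1≢0 ω-1≡0 = ω≢1 (trans (x-y≡0⇒x≡y ω-1≡0) (+-identityʳ 1#))

    1+ω+ω²≡0 : fromℕ 1 + ω + ω * ω ≡ 0#
    1+ω+ω²≡0 = x*y≡0⇒y≡0 ω-1≢0 (begin
      (ω - fromℕ 1) * (fromℕ 1 + ω + ω * ω)
        ≡⟨ solve 1 (λ w → (w :- con (ℤ.+ 1)) :* (con (ℤ.+ 1) :+ w :+ w :* w) := w :^ 3 :- con (ℤ.+ 1)) refl ω ⟩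
      ω ^ 3 - fromℕ 1                         ≡⟨ x≡y⇒x-y≡0 ω³≡fromℕ1 ⟩
      0#                                      ∎)

    ω≢0 : ω ≢ 0#
    ω≢0 ω≡0 = 1≢0 (trans (sym ω³≡1) (trans (cong (_^ 3) ω≡0) (zeroˡ _)))

    ⅓ : Carrier
    ⅓ = proj₁ (inverse (fromℕ 3) 3≢0)

    3*⅓≡1 : fromℕ 3 * ⅓ ≡ 1#
    3*⅓≡1 = proj₂ (inverse (fromℕ 3) 3≢0)

    -- The substitution x = X - s removes the quadratic term: the collision condition becomes X² + XY + Y² = 3m.
    s m : Carrier
    s = c₂ * ⅓
    m = s * s - c₁ * ⅓

    c₂≡3s : c₂ ≡ fromℕ 3 * s
    c₂≡3s = begin
      c₂                     ≡⟨ *-identityʳ c₂ ⟨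
      c₂ * 1#                ≡⟨ cong (c₂ *_) 3*⅓≡1 ⟨
      c₂ * (fromℕ 3 * ⅓)     ≡⟨ solve 3 (λ a b c → a :* (b :* c) := b :* (a :* c)) refl c₂ (fromℕ 3) ⅓ ⟩
      fromℕ 3 * s            ∎

    cubic-difference : ∀ x y → cubic x - cubic y ≡ (x - y) * (x * x + x * y + y * y + c₂ * (x + y) + c₁)
    cubic-difference x y = solve 6 (λ x y c₂ c₁ u v →
        (x :^ 3 :+ c₂ :* x :^ 2 :+ c₁ :* x :+ con (ℤ.+ 0) :* u) :- (y :^ 3 :+ c₂ :* y :^ 2 :+ c₁ :* y :+ con (ℤ.+ 0) :* v)
        := (x :- y) :* (x :* x :+ x :* y :+ y :* y :+ c₂ :* (x :+ y) :+ c₁)) refl x y c₂ c₁ _ _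

    collision : ∀ X Y → X * X + X * Y + Y * Y ≡ fromℕ 3 * m → X ≢ Y → ∃₂ λ x y → x ≢ y × cubic x ≡ cubic y
    collision X Y norm X≢Y = x , y , x≢y , x-y≡0⇒x≡y cubic-x-y≡0
      where
      x y : Carrier
      x = X - s
      y = Y - s
      x≢y : x ≢ y
      x≢y x≡y = X≢Y (x-y≡0⇒x≡y (trans (solve 3 (λ X Y s → X :- Y := (X :- s) :- (Y :- s)) refl X Y s) (x≡y⇒x-y≡0 x≡y)))
      factor≡0 : x * x + x * y + y * y + c₂ * (x + y) + c₁ ≡ 0#
      factor≡0 = begin
        x * x + x * y + y * y + c₂ * (x + y) + c₁
          ≡⟨ cong (λ c → x * x + x * y + y * y + c * (x + y) + c₁) c₂≡3s ⟩
        x * x + x * y + y * y + fromℕ 3 * s * (x + y) + c₁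
          ≡⟨ solve 4 (λ X Y s c₁ → (X :- s) :* (X :- s) :+ (X :- s) :* (Y :- s) :+ (Y :- s) :* (Y :- s)
                                     :+ con (ℤ.+ 3) :* s :* ((X :- s) :+ (Y :- s)) :+ c₁
                                   := (X :* X :+ X :* Y :+ Y :* Y) :- con (ℤ.+ 3) :* (s :* s) :+ c₁) refl X Y s c₁ ⟩
        (X * X + X * Y + Y * Y) - fromℕ 3 * (s * s) + c₁
          ≡⟨ cong (λ n → n - fromℕ 3 * (s * s) + c₁) norm ⟩
        fromℕ 3 * (s * s - c₁ * ⅓) - fromℕ 3 * (s * s) + c₁
          ≡⟨ solve 4 (λ t s c₁ i → t :* (s :* s :- c₁ :* i) :- t :* (s :* s) :+ c₁ := c₁ :- c₁ :* (t :* i)) refl (fromℕ 3) s c₁ ⅓ ⟩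
        c₁ - c₁ * (fromℕ 3 * ⅓)
          ≡⟨ cong (λ u → c₁ - c₁ * u) 3*⅓≡1 ⟩
        c₁ - c₁ * 1#
          ≡⟨ cong (λ u → c₁ - u) (*-identityʳ c₁) ⟩
        c₁ - c₁
          ≡⟨ -‿inverseʳ c₁ ⟩
        0# ∎
      cubic-x-y≡0 : cubic x - cubic y ≡ 0#
      cubic-x-y≡0 = trans (cubic-difference x y) (trans (cong ((x - y) *_) factor≡0) (zeroʳ _))

    -- Two explicit points on X² + XY + Y² = 3m built from ω; the first degenerates to X = Y exactly when m = ω².
    norm-generic : let X = ω * ω + ω * m ; Y = fromℕ 1 + m in X * X + X * Y + Y * Y ≡ fromℕ 3 * m
    norm-generic = begin
      (ω * ω + ω * m) * (ω * ω + ω * m) + (ω * ω + ω * m) * (fromℕ 1 + m) + (fromℕ 1 + m) * (fromℕ 1 + m)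
        ≡⟨ solve 2 (λ w m → (w :* w :+ w :* m) :* (w :* w :+ w :* m) :+ (w :* w :+ w :* m) :* (con (ℤ.+ 1) :+ m)
                             :+ (con (ℤ.+ 1) :+ m) :* (con (ℤ.+ 1) :+ m)
                           := con (ℤ.+ 3) :* m :+ (con (ℤ.+ 1) :+ m :+ m :* m) :* (con (ℤ.+ 1) :+ w :+ w :* w)
                             :+ (w :+ con (ℤ.+ 2) :* m) :* (w :^ 3 :- con (ℤ.+ 1))) refl ω m ⟩
      fromℕ 3 * m + (fromℕ 1 + m + m * m) * (fromℕ 1 + ω + ω * ω) + (ω + fromℕ 2 * m) * (ω ^ 3 - fromℕ 1)
        ≡⟨ cong₂ (λ u v → fromℕ 3 * m + (fromℕ 1 + m + m * m) * u + (ω + fromℕ 2 * m) * v) 1+ω+ω²≡0 (x≡y⇒x-y≡0 ω³≡fromℕ1) ⟩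
      fromℕ 3 * m + (fromℕ 1 + m + m * m) * 0# + (ω + fromℕ 2 * m) * 0#
        ≡⟨ solve 3 (λ t a b → t :+ a :* con (ℤ.+ 0) :+ b :* con (ℤ.+ 0) := t) refl (fromℕ 3 * m) _ _ ⟩
      fromℕ 3 * m ∎

    distinct-generic : m ≢ ω * ω → ω * ω + ω * m ≢ fromℕ 1 + m
    distinct-generic m≢ω² X≡Y = m≢ω² (x-y≡0⇒x≡y (x*y≡0⇒y≡0 ω-1≢0 (begin
      (ω - fromℕ 1) * (m - ω * ω)
        ≡⟨ solve 2 (λ w m → (w :- con (ℤ.+ 1)) :* (m :- w :* w)
                          := ((w :* w :+ w :* m) :- (con (ℤ.+ 1) :+ m)) :- (w :^ 3 :- con (ℤ.+ 1))) refl ω m ⟩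
      ((ω * ω + ω * m) - (fromℕ 1 + m)) - (ω ^ 3 - fromℕ 1)
        ≡⟨ cong₂ _-_ (x≡y⇒x-y≡0 X≡Y) (x≡y⇒x-y≡0 ω³≡fromℕ1) ⟩
      0# - 0#
        ≡⟨ -‿inverseʳ 0# ⟩
      0# ∎)))

    norm-special : m ≡ ω * ω → let X = fromℕ 1 + ω * ω ; Y = ω + ω in X * X + X * Y + Y * Y ≡ fromℕ 3 * m
    norm-special m≡ω² = begin
      (fromℕ 1 + ω * ω) * (fromℕ 1 + ω * ω) + (fromℕ 1 + ω * ω) * (ω + ω) + (ω + ω) * (ω + ω)
        ≡⟨ solve 1 (λ w → (con (ℤ.+ 1) :+ w :* w) :* (con (ℤ.+ 1) :+ w :* w) :+ (con (ℤ.+ 1) :+ w :* w) :* (w :+ w) :+ (w :+ w) :* (w :+ w)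
                        := con (ℤ.+ 3) :* (w :* w) :+ (con (ℤ.+ 1) :+ w :+ w :* w) :* (con (ℤ.+ 1) :+ w :+ w :* w)) refl ω ⟩
      fromℕ 3 * (ω * ω) + (fromℕ 1 + ω + ω * ω) * (fromℕ 1 + ω + ω * ω)
        ≡⟨ cong (λ u → fromℕ 3 * (ω * ω) + u * u) 1+ω+ω²≡0 ⟩
      fromℕ 3 * (ω * ω) + 0# * 0#
        ≡⟨ solve 1 (λ t → t :+ con (ℤ.+ 0) :* con (ℤ.+ 0) := t) refl (fromℕ 3 * (ω * ω)) ⟩
      fromℕ 3 * (ω * ω)
        ≡⟨ cong (fromℕ 3 *_) m≡ω² ⟨
      fromℕ 3 * m ∎

    distinct-special : fromℕ 1 + ω * ω ≢ ω + ω
    distinct-special X≡Y = x*y≢0 3≢0 ω≢0 (begin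
      fromℕ 3 * ω
        ≡⟨ solve 1 (λ w → con (ℤ.+ 3) :* w := (con (ℤ.+ 1) :+ w :+ w :* w) :- ((con (ℤ.+ 1) :+ w :* w) :- (w :+ w))) refl ω ⟩
      (fromℕ 1 + ω + ω * ω) - ((fromℕ 1 + ω * ω) - (ω + ω))
        ≡⟨ cong₂ _-_ 1+ω+ω²≡0 (x≡y⇒x-y≡0 X≡Y) ⟩
      0# - 0#
        ≡⟨ -‿inverseʳ 0# ⟩
      0# ∎)

    cubic-collision : ∃₂ λ x y → x ≢ y × cubic x ≡ cubic y
    cubic-collision with m ≟ (ω * ω)
    ... | yes m≡ω² = collision _ _ (norm-special m≡ω²) distinct-special
    ... | no m≢ω²  = collision _ _ norm-generic (distinct-generic m≢ω²)

module JProperties {q : ℕ} (F : FiniteField q) (14≤q : 14 ≤ q) (c₂ c₁ c₋₁ : FiniteField.Carrier F) where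

  open FiniteField F
  open FiniteFieldProperties F
  open RootCounting F
  open LaurentSums F (ℕP.≤-trans (ℕP.m≤m+n 3 11) 14≤q)
  open ≡-Reasoning

  J′ : Carrier → Carrier
  J′ = J F c₂ c₁ c₋₁

  J¹ : Laurent
  J¹ = (fromℕ 1 , 3 , 0) ∷ (c₂ , 2 , 0) ∷ (c₁ , 1 , 0) ∷ (c₋₁ , 0 , 1) ∷ []

  J≡J¹ : ∀ x → J′ x ≡ evalLaurent J¹ x
  J≡J¹ x = solve 5 (λ x y c₂ c₁ c → x :^ 3 :+ c₂ :* x :^ 2 :+ c₁ :* x :+ c :* y :=
    con (ℤ.+ 1) :* (x :^ 3 :* y :^ 0) :+ (c₂ :* (x :^ 2 :* y :^ 0) :+ (c₁ :* (x :^ 1 :* y :^ 0) :+ (c :* (x :^ 0 :* y :^ 1)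
    :+ con (ℤ.+ 0))))) refl x (x ⁻¹) c₂ c₁ c₋₁

  J0≡0 : J′ 0# ≡ 0#
  J0≡0 = trans (cong (λ z → 0# ^ 3 + c₂ * 0# ^ 2 + c₁ * 0# + c₋₁ * z) 0⁻¹≡0)
    (solve 3 (λ c₂ c₁ c → con (ℤ.+ 0) :^ 3 :+ c₂ :* con (ℤ.+ 0) :^ 2 :+ c₁ :* con (ℤ.+ 0) :+ c :* con (ℤ.+ 0)
                       := con (ℤ.+ 0)) refl c₂ c₁ c₋₁)

  12≤q∸2 : 12 ≤ q ∸ 2
  12≤q∸2 = ℕP.∸-monoˡ-≤ 2 14≤q

  ∑J≡0 : ∑ J′ ≡ 0#
  ∑J≡0 = begin
    ∑ J′                              ≡⟨ ∑-cong J≡J¹ ⟩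
    ∑ (evalLaurent J¹)                ≡⟨ +-identityʳ _ ⟨
    ∑ (evalLaurent J¹) + 0#           ≡⟨ ∑-evalLaurent 12≤q∸2 J¹ _ ⟩
    0#                                ∎

  J² : Laurent
  J² = (fromℕ 1 , 6 , 0) ∷ (fromℕ 2 * c₂ , 5 , 0) ∷ (c₂ * c₂ + fromℕ 2 * c₁ , 4 , 0) ∷ (fromℕ 2 * c₁ * c₂ , 3 , 0)
     ∷ (c₁ * c₁ , 2 , 0) ∷ (fromℕ 2 * c₋₁ , 3 , 1) ∷ (fromℕ 2 * c₂ * c₋₁ , 2 , 1) ∷ (fromℕ 2 * c₁ * c₋₁ , 1 , 1)
     ∷ (c₋₁ * c₋₁ , 0 , 2) ∷ []

  J^2≡J² : ∀ x → J′ x ^ 2 ≡ evalLaurent J² x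
  J^2≡J² x = solve 5 (λ x y c₂ c₁ c → (x :^ 3 :+ c₂ :* x :^ 2 :+ c₁ :* x :+ c :* y) :^ 2 :=
    con (ℤ.+ 1) :* (x :^ 6 :* y :^ 0) :+ (con (ℤ.+ 2) :* c₂ :* (x :^ 5 :* y :^ 0)
    :+ ((c₂ :* c₂ :+ con (ℤ.+ 2) :* c₁) :* (x :^ 4 :* y :^ 0) :+ (con (ℤ.+ 2) :* c₁ :* c₂ :* (x :^ 3 :* y :^ 0)
    :+ (c₁ :* c₁ :* (x :^ 2 :* y :^ 0) :+ (con (ℤ.+ 2) :* c :* (x :^ 3 :* y :^ 1)
    :+ (con (ℤ.+ 2) :* c₂ :* c :* (x :^ 2 :* y :^ 1) :+ (con (ℤ.+ 2) :* c₁ :* c :* (x :^ 1 :* y :^ 1)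
    :+ (c :* c :* (x :^ 0 :* y :^ 2) :+ con (ℤ.+ 0)))))))))) refl x (x ⁻¹) c₂ c₁ c₋₁

  J³ : Laurent
  J³ = (fromℕ 1 , 9 , 0) ∷ (fromℕ 3 * c₂ , 8 , 0) ∷ (fromℕ 3 * c₂ * c₂ , 7 , 0) ∷ (c₂ * c₂ * c₂ , 6 , 0)
     ∷ (fromℕ 3 * c₋₁ , 6 , 1) ∷ (fromℕ 6 * c₂ * c₋₁ , 5 , 1) ∷ (fromℕ 3 * c₂ * c₂ * c₋₁ , 4 , 1)
     ∷ (fromℕ 3 * c₋₁ * c₋₁ , 3 , 2) ∷ (fromℕ 3 * c₂ * c₋₁ * c₋₁ , 2 , 2) ∷ (c₋₁ * c₋₁ * c₋₁ , 0 , 3) ∷ []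

  J^3≡J³ : c₁ ≡ 0# → ∀ x → J′ x ^ 3 ≡ evalLaurent J³ x
  J^3≡J³ refl x = solve 4 (λ x y c₂ c → (x :^ 3 :+ c₂ :* x :^ 2 :+ con (ℤ.+ 0) :* x :+ c :* y) :^ 3 :=
    con (ℤ.+ 1) :* (x :^ 9 :* y :^ 0) :+ (con (ℤ.+ 3) :* c₂ :* (x :^ 8 :* y :^ 0)
    :+ (con (ℤ.+ 3) :* c₂ :* c₂ :* (x :^ 7 :* y :^ 0) :+ (c₂ :* c₂ :* c₂ :* (x :^ 6 :* y :^ 0)
    :+ (con (ℤ.+ 3) :* c :* (x :^ 6 :* y :^ 1) :+ (con (ℤ.+ 6) :* c₂ :* c :* (x :^ 5 :* y :^ 1)
    :+ (con (ℤ.+ 3) :* c₂ :* c₂ :* c :* (x :^ 4 :* y :^ 1) :+ (con (ℤ.+ 3) :* c :* c :* (x :^ 3 :* y :^ 2)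
    :+ (con (ℤ.+ 3) :* c₂ :* c :* c :* (x :^ 2 :* y :^ 2) :+ (c :* c :* c :* (x :^ 0 :* y :^ 3)
    :+ con (ℤ.+ 0))))))))))) refl x (x ⁻¹) c₂ c₋₁

  J⁴ : Laurent
  J⁴ = (fromℕ 1 , 12 , 0) ∷ (fromℕ 4 * c₋₁ , 9 , 1) ∷ (fromℕ 6 * c₋₁ * c₋₁ , 6 , 2)
     ∷ (fromℕ 4 * c₋₁ * c₋₁ * c₋₁ , 3 , 3) ∷ (c₋₁ * c₋₁ * c₋₁ * c₋₁ , 0 , 4) ∷ []

  J^4≡J⁴ : c₁ ≡ 0# → c₂ ≡ 0# → ∀ x → J′ x ^ 4 ≡ evalLaurent J⁴ x
  J^4≡J⁴ refl refl x = solve 3 (λ x y c → (x :^ 3 :+ con (ℤ.+ 0) :* x :^ 2 :+ con (ℤ.+ 0) :* x :+ c :* y) :^ 4 :=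
    con (ℤ.+ 1) :* (x :^ 12 :* y :^ 0) :+ (con (ℤ.+ 4) :* c :* (x :^ 9 :* y :^ 1)
    :+ (con (ℤ.+ 6) :* c :* c :* (x :^ 6 :* y :^ 2) :+ (con (ℤ.+ 4) :* c :* c :* c :* (x :^ 3 :* y :^ 3)
    :+ (c :* c :* c :* c :* (x :^ 0 :* y :^ 4) :+ con (ℤ.+ 0)))))) refl x (x ⁻¹) c₋₁

  module _ (J-injective : Injective _≡_ _≡_ J′) where

    diagonal≡0 : ∀ t ts → T (1 ℕ.≤ᵇ t) → T (t ℕ.≤ᵇ 4) → ExponentsAtMost 12 ts →
                 (∀ x → J′ x ^ t ≡ evalLaurent ts x) → diagonal ts ≡ 0#
    diagonal≡0 t ts 1≤t t≤4 ts≤12 J^t≡ts = begin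
      diagonal ts                       ≡⟨ +-identityˡ _ ⟨
      0# + diagonal ts                  ≡⟨ cong (_+ diagonal ts) ∑J^t≡0 ⟨
      ∑ (λ x → J′ x ^ t) + diagonal ts  ≡⟨ cong (_+ diagonal ts) (∑-cong J^t≡ts) ⟩
      ∑ (evalLaurent ts) + diagonal ts  ≡⟨ ∑-evalLaurent 12≤q∸2 ts ts≤12 ⟩
      0#                                ∎
      where
      t<q∸1 : t < q ∸ 1
      t<q∸1 = ℕP.≤-trans (s≤s (ℕP.≤ᵇ⇒≤ t 4 t≤4)) (ℕP.≤-trans (ℕP.m≤m+n 5 8) (ℕP.∸-monoˡ-≤ 1 14≤q))
      ∑J^t≡0 : ∑ (λ x → J′ x ^ t) ≡ 0#
      ∑J^t≡0 = ∑-injective-^≡0 J-injective (ℕP.≤ᵇ⇒≤ 1 t 1≤t) t<q∸1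

    -- The diagonal coefficients are 2c₁c₋₁ for J², then 3c₂c₋₁² for J³ once c₁ = 0, then 4c₋₁³ for J⁴ once c₂ = 0.
    injective⇒c₋₁≡0 : fromℕ 2 ≢ 0# → fromℕ 3 ≢ 0# → c₋₁ ≡ 0#
    injective⇒c₋₁≡0 2≢0 3≢0 with c₋₁ ≟ 0#
    ... | yes c₋₁≡0 = c₋₁≡0
    ... | no c₋₁≢0  = contradiction 4c₋₁³≡0 (x*y≢0 (x*y≢0 (x*y≢0 4≢0 c₋₁≢0) c₋₁≢0) c₋₁≢0)
      where
      4≢0 : fromℕ 4 ≢ 0#
      4≢0 4≡0 = x*y≢0 2≢0 2≢0 (trans (sym (fromℕ-* 2 2)) 4≡0)
      c₁≡0 : c₁ ≡ 0#
      c₁≡0 = x*y≡0⇒y≡0 2≢0 (x*y≡0⇒x≡0 c₋₁≢0 (trans (sym (+-identityʳ _)) (diagonal≡0 2 J² _ _ _ J^2≡J²)))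
      c₂≡0 : c₂ ≡ 0#
      c₂≡0 = x*y≡0⇒y≡0 3≢0 (x*y≡0⇒x≡0 c₋₁≢0 (x*y≡0⇒x≡0 c₋₁≢0
               (trans (sym (+-identityʳ _)) (diagonal≡0 3 J³ _ _ _ (J^3≡J³ c₁≡0)))))
      4c₋₁³≡0 : fromℕ 4 * c₋₁ * c₋₁ * c₋₁ ≡ 0#
      4c₋₁³≡0 = trans (sym (+-identityʳ _)) (diagonal≡0 4 J⁴ _ _ _ (J^4≡J⁴ c₁≡0 c₂≡0))

  J-not-injective : fromℕ 2 ≢ 0# → fromℕ 3 ≢ 0# → q % 3 ≡ 1 → ¬ Injective _≡_ _≡_ J′
  J-not-injective 2≢0 3≢0 q%3≡1 J-injective with CubeRoots.∃ω F (ℕP.≤-trans (ℕP.m≤m+n 2 12) 14≤q) q%3≡1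
  ... | ω , ω³≡1 , ω≢1 with CubeRoots.CubicCollision.cubic-collision F 3≢0 ω³≡1 ω≢1 c₂ c₁
  ...   | x , y , x≢y , cx≡cy = x≢y (J-injective (subst (λ c → J F c₂ c₁ c x ≡ J F c₂ c₁ c y) (sym c₋₁≡0) cx≡cy))
    where
    c₋₁≡0 : c₋₁ ≡ 0#
    c₋₁≡0 = injective⇒c₋₁≡0 (λ {x} {y} → J-injective {x} {y}) 2≢0 3≢0

module ValueSets {q : ℕ} (F : FiniteField q) where

  open FiniteField F
  open FiniteFieldProperties F

  index : Carrier → Fin q
  index = Inverse.from enum

  ∃? : ∀ {P : Pred Carrier 0ℓ} → Decidable P → Dec (∃ P)
  ∃? {P} P? = map′ (λ (i , p) → elt i , p) (λ (x , p) → index x , subst P (sym (elt-index x)) p) (FinP.any? (P? ∘ elt))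

  ∣_∣ : ∀ {P : Pred Carrier 0ℓ} → Decidable P → ℕ
  ∣ P? ∣ = count (P? ∘ elt)

  ∣∣-< : ∀ {P Q : Pred Carrier 0ℓ} (P? : Decidable P) (Q? : Decidable Q) → P ⊆ Q → ∀ {z} → ¬ P z → Q z → ∣ P? ∣ < ∣ Q? ∣
  ∣∣-< {P} {Q} P? Q? P⊆Q {z} ¬Pz Qz =
    count-< (P? ∘ elt) (Q? ∘ elt) P⊆Q (index z) (¬Pz ∘ subst P (elt-index z)) (subst Q (sym (elt-index z)) Qz)

  everything? : Decidable {A = Carrier} (λ _ → ⊤)
  everything? _ = yes tt

  ∣everything∣≡q : ∣ everything? ∣ ≡ q
  ∣everything∣≡q = count-full (everything? ∘ elt) (λ _ → tt)

  ∣∣<q : ∀ {P : Pred Carrier 0ℓ} (P? : Decidable P) {z} → ¬ P z → ∣ P? ∣ < q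
  ∣∣<q P? ¬Pz = subst (∣ P? ∣ <_) ∣everything∣≡q (∣∣-< P? everything? _ ¬Pz tt)

  Image : Pred Carrier 0ℓ → (Carrier → Carrier) → Pred Carrier 0ℓ
  Image D f y = ∃ λ x → D x × f x ≡ y

  count-Image≤ : ∀ {D} (D? : Decidable D) f {Im : Pred (Fin q) 0ℓ} (Im? : Decidable Im) →
                 (∀ {i} → Im i → Image D f (elt i)) → count Im? ≤ ∣ D? ∣
  count-Image≤ {D} D? f Im? Im⊆f[D] = count-image _≟_ elt elt-injective (D? ∘ elt) (f ∘ elt) Im? (from-index ∘ Im⊆f[D])
    where
    from-index : ∀ {y} → Image D f y → ∃ λ k → D (elt k) × f (elt k) ≡ y
    from-index (x , d , fx≡y) = index x , subst D (sym (elt-index x)) d , trans (cong f (elt-index x)) fx≡y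

  #V≤ : ∀ {D} (D? : Decidable D) f → (∀ x → Image D f (f x)) → #V F f ≤ ∣ D? ∣
  #V≤ D? f covered = count-Image≤ D? f _ λ (x , fx≡y) → let z , d , fz≡fx = covered x in z , d , trans fz≡fx fx≡y

  #Vˣ≤ : ∀ {D} (D? : Decidable D) f → (∀ {x} → x ≢ 0# → Image D f (f x)) → #Vˣ F f ≤ ∣ D? ∣
  #Vˣ≤ D? f covered = count-Image≤ D? f _ λ (x , x≢0 , fx≡y) → let z , d , fz≡fx = covered x≢0 in z , d , trans fz≡fx fx≡y

  #Vˣ≤#V : ∀ f → #Vˣ F f ≤ #V F f
  #Vˣ≤#V f = count-mono {n = q} _ _ λ (x , _ , fx≡y) → x , fx≡y

  missing-value : ∀ {D Q} (D? : Decidable D) (Q? : Decidable Q) f → ∣ D? ∣ < ∣ Q? ∣ → ∃ λ b → Q b × ¬ Image D f b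
  missing-value {D} D? Q? f D<Q with count-<⇒∃ Image? (Q? ∘ elt) (ℕP.≤-<-trans (count-Image≤ D? f Image? (λ im → im)) D<Q)
    where
    Image? : Decidable (Image D f ∘ elt)
    Image? i = ∃? (λ x → D? x ×-dec (f x ≟ elt i))
  ... | i , Qb , b∉f[D] = elt i , Qb , b∉f[D]

module ValueSetBounds {q : ℕ} (F : FiniteField q) (3≤q : 3 ≤ q) where

  open FiniteField F
  open FiniteFieldProperties F
  open RootCounting F using (∑-injective-^≡0)
  open ValueSets F

  _[_↦_] : (Carrier → Carrier) → Carrier → Carrier → Carrier → Carrier
  (f [ p ↦ b ]) x with x ≟ p
  ... | yes _ = b
  ... | no _  = f x

  [↦]-at : ∀ f p b → (f [ p ↦ b ]) p ≡ b
  [↦]-at f p b with p ≟ p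
  ... | yes _   = refl
  ... | no p≢p = contradiction refl p≢p

  [↦]-off : ∀ f {p} b {x} → x ≢ p → (f [ p ↦ b ]) x ≡ f x
  [↦]-off f {p} b {x} x≢p with x ≟ p
  ... | yes x≡p = contradiction x≡p x≢p
  ... | no _    = refl

  [↦]-self : ∀ f p x → (f [ p ↦ f p ]) x ≡ f x
  [↦]-self f p x with x ≟ p
  ... | yes refl = refl
  ... | no _     = refl

  [↦]-injective : ∀ {f p b} → (∀ {x y} → x ≢ p → y ≢ p → f x ≡ f y → x ≡ y) → (∀ {x} → x ≢ p → f x ≢ b) →
                  Injective _≡_ _≡_ (f [ p ↦ b ])
  [↦]-injective {f} {p} {b} injective-off-p misses-b {x} {y} e with x ≟ p | y ≟ p
  ... | yes x≡p | yes y≡p = trans x≡p (sym y≡p)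
  ... | yes _   | no y≢p  = contradiction (sym e) (misses-b y≢p)
  ... | no x≢p  | yes _   = contradiction e (misses-b x≢p)
  ... | no x≢p  | no y≢p  = injective-off-p x≢p y≢p e

  ∑-injective≡0 : ∀ {f} → Injective _≡_ _≡_ f → ∑ f ≡ 0#
  ∑-injective≡0 {f} f-injective = trans (∑-cong (λ x → sym (*-identityʳ (f x))))
    (∑-injective-^≡0 f-injective (s≤s z≤n) (ℕP.∸-monoˡ-≤ 1 3≤q))

  injective-update : ∀ {f} → ∑ f ≡ 0# → ∀ {p b} → Injective _≡_ _≡_ (f [ p ↦ b ]) → b ≡ f p
  injective-update {f} ∑f≡0 {p} {b} update-injective = +-cancelˡ 0# (begin
    0# + b                          ≡⟨ cong₂ _+_ ∑f≡0 ([↦]-at f p b) ⟨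
    ∑ f + (f [ p ↦ b ]) p           ≡⟨ ∑-update (f [ p ↦ b ]) f p (λ x x≢p → [↦]-off f b x≢p) ⟨
    ∑ (f [ p ↦ b ]) + f p           ≡⟨ cong (_+ f p) (∑-injective≡0 update-injective) ⟩
    0# + f p                        ∎)
    where open ≡-Reasoning

  m≤n∸k : ∀ k {m n} → k ℕ.+ m ≤ n → m ≤ n ∸ k
  m≤n∸k k {m} {n} k+m≤n = ℕP.m+n≤o⇒m≤o∸n m (subst (_≤ n) (ℕP.+-comm k m) k+m≤n)

  nonzero? : Decidable (_≢ 0#)
  nonzero? x = ¬? (x ≟ 0#)

  units-except? : ∀ a → Decidable (λ x → x ≢ 0# × x ≢ a)
  units-except? a x = nonzero? x ×-dec ¬? (x ≟ a)

  ∣units∖a∣<∣units∣ : ∀ {a} → a ≢ 0# → ∣ units-except? a ∣ < ∣ nonzero? ∣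
  ∣units∖a∣<∣units∣ a≢0 = ∣∣-< (units-except? _) nonzero? proj₁ (λ (_ , a≢a) → a≢a refl) a≢0

  ∣units∣<q : ∣ nonzero? ∣ < q
  ∣units∣<q = ∣∣<q nonzero? (λ 0≢0 → 0≢0 refl)

  module _ {g : Carrier → Carrier} (g0≡0 : g 0# ≡ 0#) (∑g≡0 : ∑ g ≡ 0#) (g-not-injective : ¬ Injective _≡_ _≡_ g) where

    Collision : Pred Carrier 0ℓ → Set
    Collision D = ∃₂ λ x y → D x × D y × x ≢ y × g x ≡ g y

    collision? : ∀ {D} → Decidable D → Dec (Collision D)
    collision? D? = ∃? λ x → ∃? λ y → D? x ×-dec D? y ×-dec ¬? (x ≟ y) ×-dec (g x ≟ g y)

    injective-on : ∀ {D} → ¬ Collision D → ∀ {x y} → D x → D y → g x ≡ g y → x ≡ y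
    injective-on no-collision {x} {y} Dx Dy gx≡gy =
      decidable-stable (x ≟ y) (λ x≢y → no-collision (x , y , Dx , Dy , x≢y , gx≡gy))

    -- If g were injective on the units, the value b it misses there would have to be g 0 = 0, making g injective.
    collision-on-units : Collision (_≢ 0#)
    collision-on-units with collision? nonzero?
    ... | yes collision = collision
    ... | no no-collision = contradiction (λ {x} {y} → g-injective {x} {y}) g-not-injective
      where
      missing : ∃ λ b → ⊤ × ¬ Image (_≢ 0#) g b
      missing = missing-value nonzero? everything? g (∣∣-< nonzero? everything? _ (λ 0≢0 → 0≢0 refl) tt)
      b : Carrier
      b = proj₁ missing
      update-injective : Injective _≡_ _≡_ (g [ 0# ↦ b ])
      update-injective = [↦]-injective (injective-on no-collision) (λ x≢0 gx≡b → proj₂ (proj₂ missing) (_ , x≢0 , gx≡b))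
      g-injective : Injective _≡_ _≡_ g
      g-injective {x} {y} gx≡gy = subst (λ c → Injective _≡_ _≡_ (g [ 0# ↦ c ])) (injective-update ∑g≡0 update-injective)
        update-injective (trans ([↦]-self g 0# x) (trans gx≡gy (sym ([↦]-self g 0# y))))

    record TwoCollisions : Set where
      field
        a b a′ b′ : Carrier
        a≢0 : a ≢ 0#
        b≢0 : b ≢ 0#
        a′≢0 : a′ ≢ 0#
        b′≢0 : b′ ≢ 0#
        a≢b : a ≢ b
        a′≢a : a′ ≢ a
        a′≢b : a′ ≢ b
        b′≢a : b′ ≢ a
        b′≢b : b′ ≢ b
        ga′≡ga : g a′ ≡ g a
        gb′≡gb : g b′ ≡ g b

    -- Removing a′ from a collision {a , a′} among the units leaves a set on which g still collides; otherwise
    -- a value b missed there would, by injective-update, equal g a′ = g a although a is still present.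
    collision-avoiding : ¬ InRangeˣ F g 0# → ∀ {a a′} → a ≢ 0# → a′ ≢ 0# → a ≢ a′ → g a ≡ g a′ →
                         Collision (λ x → x ≢ 0# × x ≢ a′)
    collision-avoiding 0∉Vˣ {a} {a′} a≢0 a′≢0 a≢a′ ga≡ga′ with collision? (units-except? a′)
    ... | yes collision = collision
    ... | no no-collision = contradiction (a , (a≢0 , a≢a′) , trans ga≡ga′ (sym b≡ga′)) b∉g[D]
      where
      missing : ∃ λ b → b ≢ 0# × ¬ Image (λ x → x ≢ 0# × x ≢ a′) g b
      missing = missing-value (units-except? a′) nonzero? g (∣units∖a∣<∣units∣ a′≢0)
      b : Carrier
      b = proj₁ missing
      b∉g[D] : ¬ Image (λ x → x ≢ 0# × x ≢ a′) g b
      b∉g[D] = proj₂ (proj₂ missing)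
      g≡0⇒≡0 : ∀ {x} → g x ≡ 0# → x ≡ 0#
      g≡0⇒≡0 {x} gx≡0 = decidable-stable (x ≟ 0#) (λ x≢0 → 0∉Vˣ (x , x≢0 , gx≡0))
      injective-off-a′ : ∀ {x y} → x ≢ a′ → y ≢ a′ → g x ≡ g y → x ≡ y
      injective-off-a′ {x} {y} x≢a′ y≢a′ gx≡gy with x ≟ 0# | y ≟ 0#
      ... | yes x≡0 | yes y≡0 = trans x≡0 (sym y≡0)
      ... | yes x≡0 | no _    = sym (trans (g≡0⇒≡0 (trans (sym gx≡gy) (trans (cong g x≡0) g0≡0))) (sym x≡0))
      ... | no _    | yes y≡0 = trans (g≡0⇒≡0 (trans gx≡gy (trans (cong g y≡0) g0≡0))) (sym y≡0)
      ... | no x≢0  | no y≢0  = injective-on no-collision (x≢0 , x≢a′) (y≢0 , y≢a′) gx≡gy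
      misses-b : ∀ {x} → x ≢ a′ → g x ≢ b
      misses-b {x} x≢a′ gx≡b with x ≟ 0#
      ... | yes x≡0 = proj₁ (proj₂ missing) (trans (sym gx≡b) (trans (cong g x≡0) g0≡0))
      ... | no x≢0  = b∉g[D] (x , (x≢0 , x≢a′) , gx≡b)
      b≡ga′ : b ≡ g a′
      b≡ga′ = injective-update ∑g≡0 ([↦]-injective injective-off-a′ misses-b)

    two-collisions : ¬ InRangeˣ F g 0# → TwoCollisions
    two-collisions 0∉Vˣ with collision-on-units
    ... | a , a′ , a≢0 , a′≢0 , a≢a′ , ga≡ga′ with collision-avoiding 0∉Vˣ a≢0 a′≢0 a≢a′ ga≡ga′
    ...   | x , y , (x≢0 , x≢a′) , (y≢0 , y≢a′) , x≢y , gx≡gy with a ≟ x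
    ...     | yes a≡x = record
      { a = a′ ; b = x ; a′ = y ; b′ = y ; a≢0 = a′≢0 ; b≢0 = x≢0 ; a′≢0 = y≢0 ; b′≢0 = y≢0
      ; a≢b = x≢a′ ∘ sym ; a′≢a = y≢a′ ; a′≢b = x≢y ∘ sym ; b′≢a = y≢a′ ; b′≢b = x≢y ∘ sym
      ; ga′≡ga = trans (sym gx≡gy) (trans (cong g (sym a≡x)) ga≡ga′) ; gb′≡gb = sym gx≡gy }
    ...     | no a≢x = record
      { a = a′ ; b = x ; a′ = a ; b′ = y ; a≢0 = a′≢0 ; b≢0 = x≢0 ; a′≢0 = a≢0 ; b′≢0 = y≢0
      ; a≢b = x≢a′ ∘ sym ; a′≢a = a≢a′ ; a′≢b = a≢x ; b′≢a = y≢a′ ; b′≢b = x≢y ∘ sym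
      ; ga′≡ga = ga≡ga′ ; gb′≡gb = sym gx≡gy }

    module _ (t : TwoCollisions) where

      open TwoCollisions t

      image-avoiding-collisions : ∀ {D} → D a′ → D b′ → ∀ {x} → (x ≢ a → x ≢ b → D x) → Image D g (g x)
      image-avoiding-collisions Da′ Db′ {x} D-otherwise with x ≟ a | x ≟ b
      ... | yes refl | _        = a′ , Da′ , ga′≡ga
      ... | no _     | yes refl = b′ , Db′ , gb′≡gb
      ... | no x≢a   | no x≢b   = x , D-otherwise x≢a x≢b , refl

      #V≤q∸2-by-collisions : #V F g ≤ q ∸ 2
      #V≤q∸2-by-collisions = ℕP.≤-trans (#V≤ D? g (λ x → image-avoiding-collisions (a′≢a , a′≢b) (b′≢a , b′≢b) _,_))
        (m≤n∸k 2 (ℕP.≤-trans (s≤s D<≢a) (∣∣<q ≢a? (λ a≢a → a≢a refl))))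
        where
        ≢a? : Decidable (_≢ a)
        ≢a? x = ¬? (x ≟ a)
        D? : Decidable (λ x → x ≢ a × x ≢ b)
        D? x = ≢a? x ×-dec ¬? (x ≟ b)
        D<≢a : ∣ D? ∣ < ∣ ≢a? ∣
        D<≢a = ∣∣-< D? ≢a? proj₁ (λ (_ , b≢b) → b≢b refl) (a≢b ∘ sym)

      #Vˣ≤q∸3-by-collisions : #Vˣ F g ≤ q ∸ 3
      #Vˣ≤q∸3-by-collisions = ℕP.≤-trans
        (#Vˣ≤ D? g (λ x≢0 → image-avoiding-collisions (a′≢0 , a′≢a , a′≢b) (b′≢0 , b′≢a , b′≢b) (λ x≢a x≢b → x≢0 , x≢a , x≢b)))
        (m≤n∸k 3 (ℕP.≤-trans (s≤s (s≤s D<F*∖a)) (ℕP.≤-trans (s≤s (∣units∖a∣<∣units∣ a≢0)) ∣units∣<q)))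
        where
        D? : Decidable (λ x → x ≢ 0# × x ≢ a × x ≢ b)
        D? x = nonzero? x ×-dec ¬? (x ≟ a) ×-dec ¬? (x ≟ b)
        D<F*∖a : ∣ D? ∣ < ∣ units-except? a ∣
        D<F*∖a = ∣∣-< D? (units-except? a) (λ (x≢0 , x≢a , _) → x≢0 , x≢a) (λ (_ , _ , b≢b) → b≢b refl) (b≢0 , a≢b ∘ sym)

    #V≤q∸2-when-0∈Vˣ : ∀ {x₀} → x₀ ≢ 0# → g x₀ ≡ 0# → #V F g ≤ q ∸ 2
    #V≤q∸2-when-0∈Vˣ {x₀} x₀≢0 gx₀≡0 with collision-on-units
    ... | a , a′ , a≢0 , a′≢0 , a≢a′ , ga≡ga′ =
      ℕP.≤-trans (#V≤ (units-except? a) g covered)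
        (m≤n∸k 2 (ℕP.≤-trans (s≤s (∣units∖a∣<∣units∣ a≢0)) ∣units∣<q))
      where
      a′∈F*∖a : a′ ≢ 0# × a′ ≢ a
      a′∈F*∖a = a′≢0 , a≢a′ ∘ sym
      covered : ∀ x → Image (λ z → z ≢ 0# × z ≢ a) g (g x)
      covered x with x ≟ 0# | x ≟ a | x₀ ≟ a
      ... | yes refl | _        | no x₀≢a  = x₀ , (x₀≢0 , x₀≢a) , trans gx₀≡0 (sym g0≡0)
      ... | yes refl | _        | yes refl = a′ , a′∈F*∖a , trans (sym ga≡ga′) (trans gx₀≡0 (sym g0≡0))
      ... | no _     | yes refl | _        = a′ , a′∈F*∖a , sym ga≡ga′
      ... | no x≢0   | no x≢a   | _        = x , (x≢0 , x≢a) , refl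

    #V≤q∸2 : #V F g ≤ q ∸ 2
    #V≤q∸2 with ∃? (λ x → nonzero? x ×-dec (g x ≟ 0#))
    ... | yes (x₀ , x₀≢0 , gx₀≡0) = #V≤q∸2-when-0∈Vˣ x₀≢0 gx₀≡0
    ... | no 0∉Vˣ                  = #V≤q∸2-by-collisions (two-collisions 0∉Vˣ)

    #Vˣ≤q∸3 : ¬ InRangeˣ F g 0# → #Vˣ F g ≤ q ∸ 3
    #Vˣ≤q∸3 0∉Vˣ = #Vˣ≤q∸3-by-collisions (two-collisions 0∉Vˣ)

open import Data.Nat using (_^_)
open import Data.Nat.Primality using (Prime; prime⇒irreducible)
open import Data.Nat.Divisibility using (m%n≡0⇒n∣m)
open import Function.Definitions using (Bijective)

odd-prime%2≡1 : ∀ {p} → Prime p → p ≢ 2 → p % 2 ≡ 1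
odd-prime%2≡1 {p} p-prime p≢2 with p % 2 in p%2≡r | ℕD.m%n<n p 2
... | 0           | _ = [ (λ ()) , (λ 2≡p → contradiction (sym 2≡p) p≢2) ]′ (prime⇒irreducible p-prime (m%n≡0⇒n∣m p 2 p%2≡r))
... | 1           | _ = refl
... | suc (suc _) | s≤s (s≤s ())

odd^k%2≡1 : ∀ {p} k → p % 2 ≡ 1 → (p ^ k) % 2 ≡ 1
odd^k%2≡1     zero    _      = refl
odd^k%2≡1 {p} (suc k) p%2≡1 = trans (ℕD.%-distribˡ-* p (p ^ k) 2) (cong₂ (λ a b → (a ℕ.* b) % 2) p%2≡1 (odd^k%2≡1 k p%2≡1))

lemma3p3 : (q : ℕ)
    → (∃₂ λ p k → Prime p × ¬ (p ≡ 2) × 1 ≤ k × q ≡ p ^ k)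
    → 17 ≤ q
    → q % 3 ≡ 1
    → (F : FiniteField q)
    → (c₂ c₁ c₋₁ : FiniteField.Carrier F)
    → ¬ Bijective _≡_ _≡_ (J F c₂ c₁ c₋₁)
      × #Vˣ F (J F c₂ c₁ c₋₁) ≤ #V F (J F c₂ c₁ c₋₁)
      × #V F (J F c₂ c₁ c₋₁) ≤ q ∸ 2
      × (¬ InRangeˣ F (J F c₂ c₁ c₋₁) (FiniteField.0# F) → #Vˣ F (J F c₂ c₁ c₋₁) ≤ q ∸ 3)
lemma3p3 q (p , k , p-prime , p≢2 , _ , q≡p^k) 17≤q q%3≡1 F c₂ c₁ c₋₁ =
    (λ bijective → not-injective (proj₁ bijective))
  , #Vˣ≤#V J′
  , #V≤q∸2 J0≡0 ∑J≡0 not-injective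
  , #Vˣ≤q∸3 J0≡0 ∑J≡0 not-injective
  where
  open FiniteFieldProperties F using (fromℕ≢0)
  open JProperties F (ℕP.≤-trans (ℕP.m≤m+n 14 3) 17≤q) c₂ c₁ c₋₁
  open ValueSets F using (#Vˣ≤#V)
  open ValueSetBounds F (ℕP.≤-trans (ℕP.m≤m+n 3 14) 17≤q)
  q%2≡1 : q % 2 ≡ 1
  q%2≡1 = subst (λ n → n % 2 ≡ 1) (sym q≡p^k) (odd^k%2≡1 k (odd-prime%2≡1 p-prime p≢2))
  not-injective : ¬ Injective _≡_ _≡_ J′
  not-injective = J-not-injective (fromℕ≢0 2 q%2≡1) (fromℕ≢0 3 q%3≡1) q%3≡1
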